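{- Let $p$ be a prime and $m\geq 3$ an integer with $\gcd(p,m)=1$ and $\gcd(p-1,m)=1$. Let $\ell=\min\{e\geq 1:\gcd(p^e-1,m)>1\}$, $L=\mathbb{F}_{p^\ell}$, $m'=\gcd(p^\ell-1,m)$, $H$ the group of $m'$th roots of unity in $L$, $T=\mathrm{tr}_{L/\mathbb{F}_p}(H)\subseteq\mathbb{F}_p$, and $t=|T|$. Let $n=\lceil \frac{p-1}{t-1}\rceil$. Then every integer $N\geq \ell n$ lies in $W_p(m')$, and $W_p(m')\subseteq W_p(m)$.
   Context: For a prime $p$ and a positive integer $m$, $W_p(m)$ denotes the set of integers $n\geq 0$ for which there exist $\alpha_1,\dots,\alpha_n\in\overline{\mathbb{F}}_p$ with $\alpha_i^m=1$ for all $i$ (repetitions allowed) and $\alpha_1+\cdots+\alpha_n=0$. Under the stated hypotheses one has $t\geq 2$, so $n$ is well defined. $\mathrm{tr}_{L/\mathbb{F}_p}$ is the field trace. -}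

module Defs where

open import Level using (Level; _⊔_)
open import Data.Nat as ℕ using (ℕ; zero; suc)
import Data.Fin
open Data.Fin using (Fin)
open import Data.List using (List; []; _∷_; _∷ʳ_)
open import Data.Product using (Σ; ∃; _×_)
open import Algebra.Bundles using (CommutativeRing)
open import Relation.Nullary using (¬_)

module RingOps {c ℓ : Level} (R : CommutativeRing c ℓ) where
  open CommutativeRing R
  natCast : ℕ → Carrier
  natCast zero    = 0#
  natCast (suc k) = 1# + natCast k
  pow : Carrier → ℕ → Carrier
  pow x zero    = 1#
  pow x (suc k) = x * pow x k
  -- evaluation of a coefficient list c₀ ∷ c₁ ∷ … (constant term first)
  eval : List Carrier → Carrier → Carrier
  eval []       x = 0#
  eval (a ∷ as) x = a + x * eval as x

-- An algebraically closed field of characteristic p (p prime is assumed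
-- separately), on top of the stdlib CommutativeRing bundle (setoid equality).
record ACField (c ℓ : Level) (p : ℕ) : Set (Level.suc (c ⊔ ℓ)) where
  field
    cring : CommutativeRing c ℓ
  open CommutativeRing cring public
  open RingOps cring public
  field
    1≉0       : ¬ (1# ≈ 0#)
    inverse   : ∀ x → ¬ (x ≈ 0#) → ∃ λ y → x * y ≈ 1#
    char      : natCast p ≈ 0#
    -- every polynomial of degree ≥ 1 has a root
    algClosed : ∀ (c₀ : Carrier) (cs : List Carrier) (a : Carrier) →
                ¬ (a ≈ 0#) → ∃ λ x → eval ((c₀ ∷ cs) ∷ʳ a) x ≈ 0#

module _ {c ℓ : Level} {p : ℕ} (K : ACField c ℓ p) where
  open ACField K

  sumFin : (n : ℕ) → (Fin n → Carrier) → Carrier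
  sumFin zero    f = 0#
  sumFin (suc n) f = f Data.Fin.zero + sumFin n (λ i → f (Data.Fin.suc i))

  W : ℕ → ℕ → Set (c ⊔ ℓ)
  W m n = Σ (Fin n → Carrier) λ α →
            ((i : Fin n) → pow (α i) m ≈ 1#) × (sumFin n α ≈ 0#)

  -- x ∈ L = F_{p^e} ⊆ K
  InL : ℕ → Carrier → Set ℓ
  InL e x = pow x (p ℕ.^ e) ≈ x

  trace : ℕ → Carrier → Carrier
  trace zero    x = 0#
  trace (suc e) x = pow x (p ℕ.^ e) + trace e x

  InFp : Carrier → Set ℓ
  InFp x = ∃ λ k → x ≈ natCast k

  RootsH : ℕ → ℕ → Carrier → Set ℓ
  RootsH e m′ x = InL e x × (pow x m′ ≈ 1#)

  TraceSet : ℕ → ℕ → Carrier → Set (c ⊔ ℓ)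
  TraceSet e m′ y = InFp y × (∃ λ h → RootsH e m′ h × (trace e h ≈ y))

  Card : ∀ {a} → (Carrier → Set a) → ℕ → Set (c ⊔ ℓ ⊔ a)
  Card S t = Σ (Fin t → Carrier) λ g →
               ((i : Fin t) → S (g i)) ×
               ((i j : Fin t) → g i ≈ g j → i ≡ j) ×
               ((x : Carrier) → S x → ∃ λ i → x ≈ g i)
    where open import Relation.Binary.PropositionalEquality using (_≡_)

-- ⌈ a / b ⌉ (only used with b ≥ 1; 0 for b = 0)
ceilDiv : ℕ → ℕ → ℕ
ceilDiv a zero    = zero
ceilDiv a (suc b) = (a ℕ.+ b) ℕ./ suc b

module Submission where

-- Each element of T is tr(h) = h + h^p + ⋯ + h^(p^(ℓ−1)) for some h ∈ H, a sum of ℓ m′-th roots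
-- of unity, so each element of the k-fold sumset kT ⊆ 𝔽_p is a sum of kℓ of them.  T contains
-- tr(1) = ℓ and is not a single value c: for ζ ≠ 1 with ζ^m′ = 1, minimality of ℓ makes
-- ζ^(p^i − 1) ≠ 1 for 0 < i < ℓ, so ∑ₖ ζ^(−k) tr(ζ^k) = m′ ≠ 0, whereas c ∑ₖ ζ^(−k) = 0.  Hence
-- t ≥ 2, and Cauchy–Davenport gives |kT| ≥ min(p, 1 + k(t − 1)), so kT = 𝔽_p once k ≥ n.  For
-- N ≥ ℓn write N = r + qℓ with q ≥ n and add r ones to qℓ roots summing to −r.  Finally
-- W_p(m′) ⊆ W_p(m) because m′ ∣ m.

open import Defs
open import Level using (Level; 0ℓ; _⊔_)
open import Algebra.Bundles using (CommutativeRing)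
open import Data.Bool using (Bool; T)
open import Data.Empty using (⊥-elim)
open import Data.Fin as Fin using (Fin; toℕ)
open import Data.List using (List; []; _∷_; length; replicate)
open import Data.Nat as ℕ using (ℕ; zero; suc; NonZero; _<_; _≤_)
import Data.Nat.Properties as ℕₚ
open import Data.Nat.Combinatorics using (_C_)
open import Data.Nat.Coprimality using (Coprime)
open import Data.Nat.Divisibility using (_∣_; divides)
open import Data.Nat.DivMod using (_%_; _/_; m%n<n; m≡m%n+[m/n]*n; m*n/n≡m; /-monoˡ-≤)
open import Data.Nat.Primality using (Prime; prime⇒nonZero)
open import Data.Product using (Σ; ∃; _×_; _,_; proj₁; proj₂)
open import Data.Sum using (inj₁; inj₂)
open import Data.Vec.Functional using (Vector; _++_; tail)
open import Function using (_∘_)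
open import Relation.Binary.PropositionalEquality as ≡ using (_≡_; _≗_)
open import Relation.Nullary using (¬_)

module Arithmetic where

  open import Data.Bool using (true; false; _∧_; _∨_)
  open import Data.Bool.Properties using (T?; T-∧; T-∨; ∧-comm)
  open import Data.Fin.Properties using (any?) renaming (suc-injective to Fin-suc-injective)
  open import Data.Nat
  open import Data.Nat.Properties
  open import Data.Nat.DivMod
  open import Data.Nat.Coprimality using (coprime-Bézout; prime⇒coprime; gcd≡1⇒coprime)
  import Data.Nat.Coprimality as Coprimality
  open import Data.Nat.GCD using (module Bézout; gcd; gcd[m,n]≢0)
  open import Data.Nat.Divisibility using (∣-refl; ∣-trans)
  open import Data.Nat.Solver using (module +-*-Solver)
  open import Data.Product using (∃₂)
  open import Data.Sum using (_⊎_; [_,_]′) renaming (map to ⊎-map)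
  open import Function using (id)
  open import Function.Bundles using (Equivalence)
  open import Relation.Binary.Bundles using (Setoid)
  open import Relation.Binary.Structures using (IsEquivalence)
  import Relation.Binary.Reasoning.Setoid
  open import Relation.Binary.PropositionalEquality
  open import Relation.Nullary using (yes; no; does; ⌊_⌋; _×-dec_; ¬?)
  open import Relation.Nullary.Decidable using (toWitness; fromWitness; decidable-stable)
  open import Algebra.Properties.CommutativeSemigroup +-commutativeSemigroup
    using (interchange; x∙yz≈y∙xz; xy∙z≈y∙xz; xy∙z≈xz∙y)
  open +-*-Solver using (solve; _:=_; _:+_; _:*_; con)

  indicator : Bool → ℕ
  indicator false = 0
  indicator true  = 1

  count : (ℕ → Bool) → ℕ → ℕ
  count A zero    = 0
  count A (suc n) = indicator (A n) + count A n

  infixr 6 _∪_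
  infixr 7 _∩_
  _∪_ _∩_ : (ℕ → Bool) → (ℕ → Bool) → ℕ → Bool
  (A ∪ B) z = A z ∨ B z
  (A ∩ B) z = A z ∧ B z

  indicator-mono : ∀ {a b} → (T a → T b) → indicator a ≤ indicator b
  indicator-mono {false}        _   = z≤n
  indicator-mono {true} {true}  _   = ≤-refl
  indicator-mono {true} {false} a⇒b = ⊥-elim (a⇒b _)

  module _ {A B : ℕ → Bool} where

    count-cong : ∀ n → (∀ {z} → z < n → A z ≡ B z) → count A n ≡ count B n
    count-cong zero    A≡B = refl
    count-cong (suc n) A≡B = cong₂ _+_ (cong indicator (A≡B ≤-refl)) (count-cong n (A≡B ∘ m<n⇒m<1+n))

    count-mono : ∀ n → (∀ {z} → z < n → T (A z) → T (B z)) → count A n ≤ count B n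
    count-mono zero    A⊆B = z≤n
    count-mono (suc n) A⊆B = +-mono-≤ (indicator-mono (A⊆B ≤-refl)) (count-mono n (A⊆B ∘ m<n⇒m<1+n))

    count-mono-< : ∀ n → (∀ {z} → z < n → T (A z) → T (B z)) →
                   ∀ {z} → z < n → T (B z) → ¬ T (A z) → count A n < count B n
    count-mono-< (suc n) A⊆B {z} z<1+n Bz ¬Az with m<1+n⇒m<n∨m≡n z<1+n
    ... | inj₁ z<n  = +-mono-≤-< (indicator-mono (A⊆B ≤-refl)) (count-mono-< n (A⊆B ∘ m<n⇒m<1+n) z<n Bz ¬Az)
    ... | inj₂ refl with A z | B z
    ...   | true  | _     = ⊥-elim (¬Az _)
    ...   | false | true  = s≤s (count-mono n (A⊆B ∘ m<n⇒m<1+n))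

    count-∪-∩ : ∀ n → count (A ∪ B) n + count (A ∩ B) n ≡ count A n + count B n
    count-∪-∩ zero    = refl
    count-∪-∩ (suc n) = begin
      (indicator (A n ∨ B n) + count (A ∪ B) n) + (indicator (A n ∧ B n) + count (A ∩ B) n)
        ≡⟨ interchange (indicator (A n ∨ B n)) _ _ _ ⟩
      (indicator (A n ∨ B n) + indicator (A n ∧ B n)) + (count (A ∪ B) n + count (A ∩ B) n)
        ≡⟨ cong₂ _+_ (indicator-∨-∧ (A n) (B n)) (count-∪-∩ n) ⟩
      (indicator (A n) + indicator (B n)) + (count A n + count B n)
        ≡⟨ interchange (indicator (A n)) _ _ _ ⟩
      (indicator (A n) + count A n) + (indicator (B n) + count B n)
        ∎
      where
      open ≡-Reasoning
      indicator-∨-∧ : ∀ a b → indicator (a ∨ b) + indicator (a ∧ b) ≡ indicator a + indicator b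
      indicator-∨-∧ true  true  = refl
      indicator-∨-∧ true  false = refl
      indicator-∨-∧ false b     = +-identityʳ (indicator b)

  module _ {A : ℕ → Bool} where

    count≤n : ∀ n → count A n ≤ n
    count≤n zero    = z≤n
    count≤n (suc n) = +-mono-≤ (indicator≤1 (A n)) (count≤n n)
      where
      indicator≤1 : ∀ b → indicator b ≤ 1
      indicator≤1 false = z≤n
      indicator≤1 true  = ≤-refl

    ∈⇒count>0 : ∀ n {z} → z < n → T (A z) → 0 < count A n
    ∈⇒count>0 (suc n) {z} z<1+n Az with m<1+n⇒m<n∨m≡n z<1+n
    ... | inj₁ z<n  = <-≤-trans (∈⇒count>0 n z<n Az) (m≤n+m _ (indicator (A n)))
    ... | inj₂ refl with true ← A z = s≤s z≤n

    count>0⇒∈ : ∀ n → 0 < count A n → ∃ λ z → z < n × T (A z)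
    count>0⇒∈ (suc n) pos with A n in eq
    ... | true  = n , ≤-refl , subst T (sym eq) _
    ... | false with z , z<n , Az ← count>0⇒∈ n pos = z , m<n⇒m<1+n z<n , Az

    count>1⇒∈∈ : ∀ n → 1 < count A n → ∃₂ λ z₁ z₂ → z₁ < z₂ × z₂ < n × T (A z₁) × T (A z₂)
    count>1⇒∈∈ (suc n) two with A n in eq
    ... | true  with z , z<n , Az ← count>0⇒∈ n (s≤s⁻¹ two) = z , n , z<n , ≤-refl , Az , subst T (sym eq) _
    ... | false with z₁ , z₂ , z₁<z₂ , z₂<n , Az₁ , Az₂ ← count>1⇒∈∈ n two =
      z₁ , z₂ , z₁<z₂ , m<n⇒m<1+n z₂<n , Az₁ , Az₂

    count<n⇒∉ : ∀ n → count A n < n → ∃ λ z → z < n × ¬ T (A z)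
    count<n⇒∉ (suc n) lt with A n in eq
    ... | false = n , ≤-refl , subst (¬_ ∘ T) (sym eq) (λ ())
    ... | true  with z , z<n , ¬Az ← count<n⇒∉ n (s≤s⁻¹ lt) = z , m<n⇒m<1+n z<n , ¬Az

    count≥n⇒∈ : ∀ n → n ≤ count A n → ∀ {z} → z < n → T (A z)
    count≥n⇒∈ (suc n) full {z} z<1+n with A n in eq
    ... | false = ⊥-elim (<⇒≱ full (count≤n n))
    ... | true  with m<1+n⇒m<n∨m≡n z<1+n
    ...   | inj₁ z<n  = count≥n⇒∈ n (s≤s⁻¹ full) z<n
    ...   | inj₂ refl = subst T (sym eq) _

    count-∅ : ∀ n → (∀ {z} → z < n → ¬ T (A z)) → count A n ≡ 0
    count-∅ zero    _ = refl
    count-∅ (suc n) ∅ with A n in eq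
    ... | true  = ⊥-elim (∅ ≤-refl (subst T (sym eq) _))
    ... | false = count-∅ n (∅ ∘ m<n⇒m<1+n)

    count-head-tail : ∀ n → count A (suc n) ≡ indicator (A 0) + count (A ∘ suc) n
    count-head-tail zero    = refl
    count-head-tail (suc n) = begin
      indicator (A (suc n)) + count A (suc n)
        ≡⟨ cong (indicator (A (suc n)) +_) (count-head-tail n) ⟩
      indicator (A (suc n)) + (indicator (A 0) + count (A ∘ suc) n)
        ≡⟨ x∙yz≈y∙xz (indicator (A (suc n))) (indicator (A 0)) _ ⟩
      indicator (A 0) + (indicator (A (suc n)) + count (A ∘ suc) n)
        ∎
      where
      open ≡-Reasoning

  count-rotate : ∀ n .{{_ : NonZero n}} (A : ℕ → Bool) → count (λ z → A (suc z % n)) n ≡ count A n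
  count-rotate (suc n) A = begin
    indicator (A (suc n % suc n)) + count (λ z → A (suc z % suc n)) n
      ≡⟨ cong₂ (λ a c → indicator (A a) + c) (n%n≡0 (suc n))
               (count-cong n (cong A ∘ m<n⇒m%n≡m ∘ s≤s)) ⟩
    indicator (A 0) + count (A ∘ suc) n
      ≡⟨ count-head-tail n ⟨
    count A (suc n)
      ∎
    where open ≡-Reasoning

  image : ∀ {k} → (Fin k → ℕ) → ℕ → Bool
  image r y = does (any? λ i → r i ≟ y)

  image⁻ : ∀ {k} (r : Fin k → ℕ) {y} → T (image r y) → ∃ λ i → r i ≡ y
  image⁻ r {y} y∈r with any? (λ i → r i ≟ y)
  ... | yes r⁻¹y = r⁻¹y

  count-image : ∀ n {k} (r : Fin k → ℕ) → (∀ i → r i < n) → (∀ {i j} → r i ≡ r j → i ≡ j) →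
                k ≤ count (image r) n
  count-image n {zero}  r r<n r-inj = z≤n
  count-image n {suc k} r r<n r-inj = begin
    suc k
      ≤⟨ +-mono-≤ (∈⇒count>0 n (r<n Fin.zero) (≡⇒≡ᵇ (r Fin.zero) _ refl))
                  (count-image n (r ∘ Fin.suc) (r<n ∘ Fin.suc) (Fin-suc-injective ∘ r-inj)) ⟩
    count imageHead n + count imageTail n
      ≡⟨ count-∪-∩ n ⟨
    count (imageHead ∪ imageTail) n + count (imageHead ∩ imageTail) n
      ≡⟨ cong (count (image r) n +_) (count-∅ n disjoint) ⟩
    count (image r) n + 0
      ≡⟨ +-identityʳ _ ⟩
    count (image r) n
      ∎
    where
    open ≤-Reasoning
    imageHead imageTail : ℕ → Bool
    imageHead y = r Fin.zero ≡ᵇ y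
    imageTail = image (r ∘ Fin.suc)
    disjoint : ∀ {y} → y < n → ¬ T ((imageHead ∩ imageTail) y)
    disjoint {y} _ y∈both with true ← imageHead y in r₀≡ᵇy
      with i , rᵢ≡y ← image⁻ (r ∘ Fin.suc) y∈both
      with () ← r-inj (trans (≡ᵇ⇒≡ _ _ (subst T (sym r₀≡ᵇy) _)) (sym rᵢ≡y))

  module Residues (p : ℕ) .{{_ : NonZero p}} where

    infix 4 _≡ₘ_
    record _≡ₘ_ (a b : ℕ) : Set where
      constructor mod-≡
      field %-≡ : a % p ≡ b % p
    open _≡ₘ_ public

    ≡ₘ-isEquivalence : IsEquivalence _≡ₘ_
    ≡ₘ-isEquivalence = record
      { refl  = mod-≡ refl
      ; sym   = λ (mod-≡ e) → mod-≡ (sym e)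
      ; trans = λ (mod-≡ e) (mod-≡ f) → mod-≡ (trans e f)
      }

    ≡ₘ-setoid : Setoid 0ℓ 0ℓ
    ≡ₘ-setoid = record { isEquivalence = ≡ₘ-isEquivalence }

    open IsEquivalence ≡ₘ-isEquivalence public
      renaming (refl to ≡ₘ-refl; sym to ≡ₘ-sym; trans to ≡ₘ-trans)

    module ≡ₘ-Reasoning = Relation.Binary.Reasoning.Setoid ≡ₘ-setoid

    ≡⇒≡ₘ : ∀ {a b} → a ≡ b → a ≡ₘ b
    ≡⇒≡ₘ refl = ≡ₘ-refl

    %-≡ₘ : ∀ a → a % p ≡ₘ a
    %-≡ₘ a = mod-≡ (m%n%n≡m%n a p)

    +-cong-≡ₘ : ∀ {a b c d} → a ≡ₘ b → c ≡ₘ d → a + c ≡ₘ b + d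
    +-cong-≡ₘ {a} {b} {c} {d} (mod-≡ e) (mod-≡ f) = mod-≡ (begin
      (a + c) % p             ≡⟨ %-distribˡ-+ a c p ⟩
      (a % p + c % p) % p     ≡⟨ cong₂ (λ x y → (x + y) % p) e f ⟩
      (b % p + d % p) % p     ≡⟨ %-distribˡ-+ b d p ⟨
      (b + d) % p             ∎)
      where open ≡-Reasoning

    *-cong-≡ₘ : ∀ {a b c d} → a ≡ₘ b → c ≡ₘ d → a * c ≡ₘ b * d
    *-cong-≡ₘ {a} {b} {c} {d} (mod-≡ e) (mod-≡ f) = mod-≡ (begin
      (a * c) % p             ≡⟨ %-distribˡ-* a c p ⟩
      (a % p * (c % p)) % p   ≡⟨ cong₂ (λ x y → (x * y) % p) e f ⟩
      (b % p * (d % p)) % p   ≡⟨ %-distribˡ-* b d p ⟨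
      (b * d) % p             ∎)
      where open ≡-Reasoning

    +-multiple-≡ₘ : ∀ a k → a + k * p ≡ₘ a
    +-multiple-≡ₘ a k = mod-≡ ([m+kn]%n≡m%n a k p)

    ≡ₘ⇒≡ : ∀ {a b} → a < p → b < p → a ≡ₘ b → a ≡ b
    ≡ₘ⇒≡ {a} {b} a<p b<p (mod-≡ e) = begin
      a      ≡⟨ m<n⇒m%n≡m a<p ⟨
      a % p  ≡⟨ e ⟩
      b % p  ≡⟨ m<n⇒m%n≡m b<p ⟩
      b      ∎
      where open ≡-Reasoning

    -- Negation mod p as (p − 1) x, which avoids truncated subtraction.
    -ₘ_ : ℕ → ℕ
    -ₘ x = pred p * x

    +-inverseʳ-≡ₘ : ∀ x → x + -ₘ x ≡ₘ 0
    +-inverseʳ-≡ₘ x = ≡ₘ-trans (≡⇒≡ₘ x+[p-1]x≡x*p) (+-multiple-≡ₘ 0 x)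
      where
      x+[p-1]x≡x*p : x + pred p * x ≡ x * p
      x+[p-1]x≡x*p = trans (*-comm (suc (pred p)) x) (cong (x *_) (suc-pred p))

    +-cancelˡ-≡ₘ : ∀ x {a b} → x + a ≡ₘ x + b → a ≡ₘ b
    +-cancelˡ-≡ₘ x {a} {b} e = begin
      a                   ≈⟨ cancel a ⟨
      (x + -ₘ x) + a      ≡⟨ xy∙z≈y∙xz x (-ₘ x) a ⟩
      -ₘ x + (x + a)      ≈⟨ +-cong-≡ₘ (≡ₘ-refl { -ₘ x}) e ⟩
      -ₘ x + (x + b)      ≡⟨ xy∙z≈y∙xz x (-ₘ x) b ⟨
      (x + -ₘ x) + b      ≈⟨ cancel b ⟩
      b                   ∎
      where
      open ≡ₘ-Reasoning
      cancel : ∀ c → (x + -ₘ x) + c ≡ₘ c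
      cancel c = +-cong-≡ₘ (+-inverseʳ-≡ₘ x) (≡ₘ-refl {c})

    infixl 6 _⊕_ _⊖_
    _⊕_ : ℕ → ℕ → ℕ
    x ⊕ y = (x + y) % p

    _⊖_ : ℕ → ℕ → ℕ
    z ⊖ x = z ⊕ -ₘ x

    ⊕<p : ∀ x y → x ⊕ y < p
    ⊕<p x y = m%n<n (x + y) p

    +-⊖-≡ₘ : ∀ x z → x + (z ⊖ x) ≡ₘ z
    +-⊖-≡ₘ x z = begin
      x + (z ⊖ x)        ≈⟨ +-cong-≡ₘ (≡ₘ-refl {x}) (%-≡ₘ (z + -ₘ x)) ⟩
      x + (z + -ₘ x)     ≡⟨ x∙yz≈y∙xz x z (-ₘ x) ⟩
      z + (x + -ₘ x)     ≈⟨ +-cong-≡ₘ (≡ₘ-refl {z}) (+-inverseʳ-≡ₘ x) ⟩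
      z + 0              ≡⟨ +-identityʳ z ⟩
      z                  ∎
      where open ≡ₘ-Reasoning

    ⊖-unique : ∀ {x y z} → y < p → x + y ≡ₘ z → z ⊖ x ≡ y
    ⊖-unique {x} {y} {z} y<p e =
      ≡ₘ⇒≡ (⊕<p z (-ₘ x)) y<p (+-cancelˡ-≡ₘ x (≡ₘ-trans (+-⊖-≡ₘ x z) (≡ₘ-sym e)))

    ⊕-⊖-cancel : ∀ {z} e → z < p → (z ⊕ e) ⊖ e ≡ z
    ⊕-⊖-cancel {z} e z<p = ⊖-unique z<p (≡ₘ-sym (≡ₘ-trans (%-≡ₘ (z + e)) (≡⇒≡ₘ (+-comm z e))))

    ⊖-⊕-cancel : ∀ x {z} → z < p → x ⊕ (z ⊖ x) ≡ z
    ⊖-⊕-cancel x {z} z<p =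
      ≡ₘ⇒≡ (⊕<p x (z ⊖ x)) z<p (≡ₘ-trans (%-≡ₘ (x + (z ⊖ x))) (+-⊖-≡ₘ x z))

    ⊕-+-⊖-≡ₘ : ∀ x y e → (y ⊕ e) + (x ⊖ e) ≡ₘ x + y
    ⊕-+-⊖-≡ₘ x y e = begin
      (y ⊕ e) + (x ⊖ e)          ≈⟨ +-cong-≡ₘ (%-≡ₘ (y + e)) (%-≡ₘ (x + -ₘ e)) ⟩
      (y + e) + (x + -ₘ e)       ≡⟨ interchange y e x (-ₘ e) ⟩
      (y + x) + (e + -ₘ e)       ≡⟨ cong (_+ (e + -ₘ e)) (+-comm y x) ⟩
      (x + y) + (e + -ₘ e)       ≈⟨ +-cong-≡ₘ (≡ₘ-refl {x + y}) (+-inverseʳ-≡ₘ e) ⟩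
      (x + y) + 0                ≡⟨ +-identityʳ (x + y) ⟩
      x + y                      ∎
      where open ≡ₘ-Reasoning

    module _ (p-prime : Prime p) where

      inverse-≡ₘ : ∀ {d} → 0 < d → d < p → ∃ λ i → i * d ≡ₘ 1
      inverse-≡ₘ {d} 0<d d<p with coprime-Bézout (Coprimality.sym (prime⇒coprime p-prime {{>-nonZero 0<d}} d<p))
      ... | Bézout.+- x y eq = x , ≡ₘ-trans (≡⇒≡ₘ (sym eq)) (+-multiple-≡ₘ 1 y)
      ... | Bézout.-+ x y eq = -ₘ x , (begin
        -ₘ x * d                     ≈⟨ +-multiple-≡ₘ (-ₘ x * d) y ⟨
        -ₘ x * d + y * p             ≡⟨ cong (-ₘ x * d +_) eq ⟨
        -ₘ x * d + (1 + x * d)       ≡⟨ solve 3 (λ x d q → q :* x :* d :+ (con 1 :+ x :* d)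
                                                      := con 1 :+ (x :* d) :* (con 1 :+ q)) refl x d (pred p) ⟩
        1 + (x * d) * suc (pred p)   ≡⟨ cong (λ q → 1 + (x * d) * q) (suc-pred p) ⟩
        1 + (x * d) * p              ≈⟨ +-multiple-≡ₘ 1 (x * d) ⟩
        1                            ∎)
        where open ≡ₘ-Reasoning

      multiples-reach : ∀ {d} → 0 < d → d < p → ∀ a z → ∃ λ k → a + k * d ≡ₘ z
      multiples-reach {d} 0<d d<p a z with i , i*d≡1 ← inverse-≡ₘ 0<d d<p = i * (z + -ₘ a) , (begin
        a + i * (z + -ₘ a) * d
          ≡⟨ cong (a +_) (solve 3 (λ i w d → i :* w :* d := w :* (i :* d)) refl i (z + -ₘ a) d) ⟩
        a + (z + -ₘ a) * (i * d)
          ≈⟨ +-cong-≡ₘ (≡ₘ-refl {a}) (*-cong-≡ₘ (≡ₘ-refl {z + -ₘ a}) i*d≡1) ⟩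
        a + (z + -ₘ a) * 1          ≡⟨ cong (a +_) (*-identityʳ (z + -ₘ a)) ⟩
        a + (z + -ₘ a)              ≡⟨ x∙yz≈y∙xz a z (-ₘ a) ⟩
        z + (a + -ₘ a)              ≈⟨ +-cong-≡ₘ (≡ₘ-refl {z}) (+-inverseʳ-≡ₘ a) ⟩
        z + 0                       ≡⟨ +-identityʳ z ⟩
        z                           ∎)
        where open ≡ₘ-Reasoning

    count-translate : ∀ A e → count (λ z → A (z ⊕ e)) p ≡ count A p
    count-translate A zero    =
      count-cong p (λ {z} z<p → cong A (trans (cong (_% p) (+-identityʳ z)) (m<n⇒m%n≡m z<p)))
    count-translate A (suc e) = begin
      count (λ z → A (z ⊕ suc e)) p         ≡⟨ count-cong p (λ {z} _ → cong A (%-≡ (rotate-step z))) ⟩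
      count (λ z → A ((suc z % p) ⊕ e)) p   ≡⟨ count-rotate p (λ w → A (w ⊕ e)) ⟩
      count (λ w → A (w ⊕ e)) p             ≡⟨ count-translate A e ⟩
      count A p                             ∎
      where
      open ≡-Reasoning
      rotate-step : ∀ z → z + suc e ≡ₘ suc z % p + e
      rotate-step z = ≡ₘ-trans (≡⇒≡ₘ (+-suc z e)) (+-cong-≡ₘ (≡ₘ-sym (%-≡ₘ (suc z))) (≡ₘ-refl {e}))

  module CauchyDavenport (p : ℕ) (p-prime : Prime p) where

    private instance
      p≢0 : NonZero p
      p≢0 = prime⇒nonZero p-prime

    open Residues p

    -- Subsets of ℤ/p are Boolean predicates on ℕ; only their values below p matter.
    ∣_∣ : (ℕ → Bool) → ℕ
    ∣ A ∣ = count A p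

    infix 4 _⊆_
    _⊆_ : (ℕ → Bool) → (ℕ → Bool) → Set
    A ⊆ B = ∀ {z} → z < p → T (A z) → T (B z)

    infixl 6 _⊞_
    _⊞_ : (ℕ → Bool) → (ℕ → Bool) → ℕ → Bool
    (A ⊞ B) z = ⌊ anyUpTo? (λ x → T? (A x) ×-dec T? (B (z ⊖ x))) p ⌋

    ⊞-intro : ∀ {A B x y z} → x < p → y < p → x + y ≡ₘ z → T (A x) → T (B y) → T ((A ⊞ B) z)
    ⊞-intro {B = B} x<p y<p x+y≡z Ax By =
      fromWitness (_ , x<p , Ax , subst (T ∘ B) (sym (⊖-unique y<p x+y≡z)) By)

    ⊞-elim : ∀ {A B z} → T ((A ⊞ B) z) → ∃₂ λ x y → x < p × y < p × x + y ≡ₘ z × T (A x) × T (B y)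
    ⊞-elim {z = z} z∈A⊞B with x , x<p , Ax , B[z⊖x] ← toWitness z∈A⊞B =
      x , z ⊖ x , x<p , ⊕<p z (-ₘ x) , +-⊖-≡ₘ x z , Ax , B[z⊖x]

    ∣∣-mono : ∀ {A B} → A ⊆ B → ∣ A ∣ ≤ ∣ B ∣
    ∣∣-mono = count-mono p

    ∣A∣≤∣A⊞B∣ : ∀ {A B b} → b < p → T (B b) → ∣ A ∣ ≤ ∣ A ⊞ B ∣
    ∣A∣≤∣A⊞B∣ {A} {B} {b} b<p Bb = begin
      ∣ A ∣                  ≡⟨ count-translate A (-ₘ b) ⟨
      ∣ (λ z → A (z ⊖ b)) ∣  ≤⟨ ∣∣-mono (λ {z} _ A[z⊖b] → ⊞-intro (⊕<p z (-ₘ b)) b<p (z⊖b+b≡z z) A[z⊖b] Bb) ⟩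
      ∣ A ⊞ B ∣              ∎
      where
      open ≤-Reasoning
      z⊖b+b≡z : ∀ z → z ⊖ b + b ≡ₘ z
      z⊖b+b≡z z = ≡ₘ-trans (≡⇒≡ₘ (+-comm (z ⊖ b) b)) (+-⊖-≡ₘ b z)

    closed-under-shift⇒full : ∀ {A d a₀} → 0 < d → d < p → a₀ < p → T (A a₀) →
                              (∀ {a} → a < p → T (A a) → T (A (a ⊕ d))) → ∀ {z} → z < p → T (A z)
    closed-under-shift⇒full {A} {d} {a₀} 0<d d<p a₀<p Aa₀ closed {z} z<p
      with k , a₀+kd≡z ← multiples-reach p-prime 0<d d<p a₀ z =
      subst (T ∘ A) (≡ₘ⇒≡ (m%n<n _ p) z<p (≡ₘ-trans (%-≡ₘ _) a₀+kd≡z)) (orbit k)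
      where
      orbit : ∀ k → T (A ((a₀ + k * d) % p))
      orbit zero    = subst (T ∘ A) (sym (trans (cong (_% p) (+-identityʳ a₀)) (m<n⇒m%n≡m a₀<p))) Aa₀
      orbit (suc k) = subst (T ∘ A) (%-≡ step) (closed (m%n<n _ p) (orbit k))
        where
        step : (a₀ + k * d) % p + d ≡ₘ a₀ + suc k * d
        step = ≡ₘ-trans (+-cong-≡ₘ (%-≡ₘ (a₀ + k * d)) (≡ₘ-refl {d}))
                        (≡⇒≡ₘ (trans (+-assoc a₀ (k * d) d) (cong (a₀ +_) (+-comm (k * d) d))))

    shift-escapes : ∀ {A d} → 0 < ∣ A ∣ → ∣ A ∣ < p → 0 < d → d < p →
                    ∃ λ a → a < p × T (A a) × ¬ T (A (a ⊕ d))
    shift-escapes {A} {d} A≢∅ A≢full 0<d d<p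
      with anyUpTo? (λ a → T? (A a) ×-dec ¬? (T? (A (a ⊕ d)))) p
    ... | yes escape = escape
    ... | no ∄escape
      with a₀ , a₀<p , Aa₀ ← count>0⇒∈ p A≢∅
         | z , z<p , ¬Az ← count<n⇒∉ p A≢full
      = ⊥-elim (¬Az (closed-under-shift⇒full 0<d d<p a₀<p Aa₀ closed z<p))
      where
      closed : ∀ {a} → a < p → T (A a) → T (A (a ⊕ d))
      closed {a} a<p Aa = decidable-stable (T? (A (a ⊕ d))) (λ ¬Aa⊕d → ∄escape (a , a<p , Aa , ¬Aa⊕d))

    record DavenportTransform (A B : ℕ → Bool) : Set where
      field
        A′ B′          : ℕ → Bool
        A⊆A′           : A ⊆ A′
        B′-nonempty    : 0 < ∣ B′ ∣
        B′-smaller     : ∣ B′ ∣ < ∣ B ∣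
        size-preserved : ∣ A′ ∣ + ∣ B′ ∣ ≡ ∣ A ∣ + ∣ B ∣
        A′⊞B′⊆A⊞B      : A′ ⊞ B′ ⊆ A ⊞ B

    davenport-transform : ∀ {A B a b₁ b₂} → b₁ < b₂ → b₂ < p → T (B b₁) → T (B b₂) →
                          a < p → T (A a) → ¬ T (A (a ⊕ (b₂ ∸ b₁))) → DavenportTransform A B
    davenport-transform {A} {B} {a} {b₁} {b₂} b₁<b₂ b₂<p Bb₁ Bb₂ a<p Aa ¬A[a⊕d] = record
      { A′             = A ∪ Bₑ
      ; B′             = B ∩ Aₑ
      ; A⊆A′           = λ {z} _ Az → Equivalence.from (T-∨ {A z}) (inj₁ Az)
      ; B′-nonempty    = ∈⇒count>0 p (<-trans b₁<b₂ b₂<p) b₁∈B∩Aₑ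
      ; B′-smaller     = count-mono-< p (λ {z} _ → proj₁ ∘ Equivalence.to (T-∧ {B z})) b₂<p Bb₂ b₂∉B∩Aₑ
      ; size-preserved = size-preserved
      ; A′⊞B′⊆A⊞B      = A∪Bₑ⊞B∩Aₑ⊆A⊞B
      }
      where
      -- e = a − b₁ puts b₁ into B′ (b₁ + e = a ∈ A) but not b₂ (b₂ + e = a + (b₂ − b₁) ∉ A).
      e : ℕ
      e = a ⊖ b₁
      Aₑ Bₑ : ℕ → Bool
      Aₑ y = A (y ⊕ e)
      Bₑ x = B (x ⊖ e)

      b₁∈B∩Aₑ : T ((B ∩ Aₑ) b₁)
      b₁∈B∩Aₑ = Equivalence.from (T-∧ {B b₁}) (Bb₁ , subst (T ∘ A) (sym (⊖-⊕-cancel b₁ a<p)) Aa)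

      b₂∉B∩Aₑ : ¬ T ((B ∩ Aₑ) b₂)
      b₂∉B∩Aₑ = ¬A[a⊕d] ∘ subst (T ∘ A) (%-≡ b₂+e≡a+d) ∘ proj₂ ∘ Equivalence.to (T-∧ {B b₂})
        where
        open ≡ₘ-Reasoning
        d : ℕ
        d = b₂ ∸ b₁
        b₂+e≡a+d : b₂ + e ≡ₘ a + d
        b₂+e≡a+d = begin
          b₂ + e          ≡⟨ cong (_+ e) (m+[n∸m]≡n (<⇒≤ b₁<b₂)) ⟨
          (b₁ + d) + e    ≡⟨ xy∙z≈xz∙y b₁ d e ⟩
          (b₁ + e) + d    ≈⟨ +-cong-≡ₘ (+-⊖-≡ₘ b₁ a) (≡ₘ-refl {d}) ⟩
          a + d           ∎

      size-preserved : ∣ A ∪ Bₑ ∣ + ∣ B ∩ Aₑ ∣ ≡ ∣ A ∣ + ∣ B ∣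
      size-preserved = begin
        ∣ A ∪ Bₑ ∣ + ∣ B ∩ Aₑ ∣    ≡⟨ cong (∣ A ∪ Bₑ ∣ +_) ∣B∩Aₑ∣≡∣A∩Bₑ∣ ⟩
        ∣ A ∪ Bₑ ∣ + ∣ A ∩ Bₑ ∣    ≡⟨ count-∪-∩ p ⟩
        ∣ A ∣ + ∣ Bₑ ∣             ≡⟨ cong (∣ A ∣ +_) (count-translate B (-ₘ e)) ⟩
        ∣ A ∣ + ∣ B ∣              ∎
        where
        open ≡-Reasoning
        ∣B∩Aₑ∣≡∣A∩Bₑ∣ : ∣ B ∩ Aₑ ∣ ≡ ∣ A ∩ Bₑ ∣
        ∣B∩Aₑ∣≡∣A∩Bₑ∣ = begin
          ∣ B ∩ Aₑ ∣                         ≡⟨ count-cong p (λ {z} z<p → trans (∧-comm (B z) (Aₑ z))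
                                                   (cong (λ w → Aₑ z ∧ B w) (sym (⊕-⊖-cancel e z<p)))) ⟩
          ∣ (λ z → (A ∩ Bₑ) (z ⊕ e)) ∣       ≡⟨ count-translate (A ∩ Bₑ) e ⟩
          ∣ A ∩ Bₑ ∣                         ∎

      A∪Bₑ⊞B∩Aₑ⊆A⊞B : (A ∪ Bₑ) ⊞ (B ∩ Aₑ) ⊆ A ⊞ B
      A∪Bₑ⊞B∩Aₑ⊆A⊞B _ z∈A′⊞B′
        with x , y , x<p , y<p , x+y≡z , x∈A∪Bₑ , y∈B∩Aₑ ← ⊞-elim z∈A′⊞B′
        with By , Ay⊕e ← Equivalence.to (T-∧ {B y}) y∈B∩Aₑ
        with Equivalence.to (T-∨ {A x}) x∈A∪Bₑ
      ... | inj₁ Ax    = ⊞-intro {A} {B} x<p y<p x+y≡z Ax By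
      ... | inj₂ Bx⊖e =
        ⊞-intro {A} {B} (⊕<p y e) (⊕<p x (-ₘ e)) (≡ₘ-trans (⊕-+-⊖-≡ₘ x y e) x+y≡z) Ay⊕e Bx⊖e

    cauchy-davenport : ∀ {A B} → 0 < ∣ A ∣ → 0 < ∣ B ∣ →
                       p ≤ ∣ A ⊞ B ∣ ⊎ ∣ A ∣ + ∣ B ∣ ≤ suc ∣ A ⊞ B ∣
    cauchy-davenport {B = B} = by-induction-on-∣B∣ ∣ B ∣ ≤-refl
      where
      by-induction-on-∣B∣ : ∀ k {A B} → ∣ B ∣ ≤ k → 0 < ∣ A ∣ → 0 < ∣ B ∣ →
                            p ≤ ∣ A ⊞ B ∣ ⊎ ∣ A ∣ + ∣ B ∣ ≤ suc ∣ A ⊞ B ∣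
      by-induction-on-∣B∣ zero    ∣B∣≤0 _ B≢∅ = ⊥-elim (<⇒≱ B≢∅ ∣B∣≤0)
      by-induction-on-∣B∣ (suc k) {A} {B} ∣B∣≤1+k A≢∅ B≢∅
        with b , b<p , Bb ← count>0⇒∈ p B≢∅ | 1 <? ∣ B ∣ | p ≤? ∣ A ∣
      ... | no ∣B∣≤1 | _ = inj₂ (begin
        ∣ A ∣ + ∣ B ∣      ≤⟨ +-monoʳ-≤ ∣ A ∣ (≮⇒≥ ∣B∣≤1) ⟩
        ∣ A ∣ + 1          ≡⟨ +-comm ∣ A ∣ 1 ⟩
        suc ∣ A ∣          ≤⟨ s≤s (∣A∣≤∣A⊞B∣ b<p Bb) ⟩
        suc ∣ A ⊞ B ∣      ∎)
        where open ≤-Reasoning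
      ... | yes _ | yes A-full = inj₁ (≤-trans A-full (∣A∣≤∣A⊞B∣ b<p Bb))
      ... | yes ∣B∣>1 | no A≢full
        with b₁ , b₂ , b₁<b₂ , b₂<p , Bb₁ , Bb₂ ← count>1⇒∈∈ p ∣B∣>1
        with a , a<p , Aa , ¬A[a⊕d] ←
               shift-escapes A≢∅ (≰⇒> A≢full) (m<n⇒0<n∸m b₁<b₂) (≤-<-trans (m∸n≤m b₂ b₁) b₂<p)
        = transfer (davenport-transform b₁<b₂ b₂<p Bb₁ Bb₂ a<p Aa ¬A[a⊕d])
        where
        transfer : DavenportTransform A B → p ≤ ∣ A ⊞ B ∣ ⊎ ∣ A ∣ + ∣ B ∣ ≤ suc ∣ A ⊞ B ∣
        transfer τ = ⊎-map (λ full → ≤-trans full (∣∣-mono A′⊞B′⊆A⊞B)) large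
          (by-induction-on-∣B∣ k (s≤s⁻¹ (<-≤-trans B′-smaller ∣B∣≤1+k))
                                 (≤-trans A≢∅ (∣∣-mono A⊆A′)) B′-nonempty)
          where
          open DavenportTransform τ
          open ≤-Reasoning
          large : ∣ A′ ∣ + ∣ B′ ∣ ≤ suc ∣ A′ ⊞ B′ ∣ → ∣ A ∣ + ∣ B ∣ ≤ suc ∣ A ⊞ B ∣
          large A′⊞B′-large = begin
            ∣ A ∣ + ∣ B ∣       ≡⟨ size-preserved ⟨
            ∣ A′ ∣ + ∣ B′ ∣     ≤⟨ A′⊞B′-large ⟩
            suc ∣ A′ ⊞ B′ ∣     ≤⟨ s≤s (∣∣-mono A′⊞B′⊆A⊞B) ⟩
            suc ∣ A ⊞ B ∣       ∎

    infixl 7 _⊞^_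
    _⊞^_ : (ℕ → Bool) → ℕ → ℕ → Bool
    A ⊞^ zero  = _≡ᵇ 0
    A ⊞^ suc k = A ⊞^ k ⊞ A

    ∣⊞^∣-bound : ∀ {A t} → suc t ≤ ∣ A ∣ → ∀ k →
                 p ≤ ∣ A ⊞^ k ∣ ⊎ suc (k * t) ≤ ∣ A ⊞^ k ∣
    ∣⊞^∣-bound t<∣A∣ zero = inj₂ (∈⇒count>0 p (>-nonZero⁻¹ p) (≡⇒≡ᵇ 0 0 refl))
    ∣⊞^∣-bound {A} {t} t<∣A∣ (suc k)
      with a , a<p , Aa ← count>0⇒∈ p (≤-trans (s≤s z≤n) t<∣A∣) | ∣⊞^∣-bound t<∣A∣ k
    ... | inj₁ A⊞^k-full = inj₁ (≤-trans A⊞^k-full (∣A∣≤∣A⊞B∣ a<p Aa))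
    ... | inj₂ A⊞^k-large
      with cauchy-davenport (≤-trans (s≤s z≤n) A⊞^k-large) (≤-trans (s≤s z≤n) t<∣A∣)
    ...   | inj₁ full = inj₁ full
    ...   | inj₂ cd   = inj₂ (s≤s⁻¹ (begin
      suc (suc (suc k * t))         ≡⟨ cong (suc ∘ suc) (+-comm t (k * t)) ⟩
      suc (suc (k * t + t))         ≡⟨ cong suc (+-suc (k * t) t) ⟨
      suc (k * t) + suc t           ≤⟨ +-mono-≤ A⊞^k-large t<∣A∣ ⟩
      ∣ A ⊞^ k ∣ + ∣ A ∣            ≤⟨ cd ⟩
      suc ∣ A ⊞^ suc k ∣            ∎))
      where open ≤-Reasoning

    ⊞^-full : ∀ {A t k} → suc t ≤ ∣ A ∣ → p ≤ suc (k * t) → ∀ {z} → z < p → T ((A ⊞^ k) z)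
    ⊞^-full {t = t} {k} t<∣A∣ p≤1+kt =
      count≥n⇒∈ p ([ id , ≤-trans p≤1+kt ]′ (∣⊞^∣-bound t<∣A∣ k))

  module _ {p} (p-prime : Prime p) where
    open import Data.Nat.Combinatorics using (nCk≡n!/k![n-k]!; k![n∸k]!∣n!)
    open import Data.Nat.Divisibility using (∣⇒≤; m∣m*n)
    open import Data.Nat.Primality using (euclidsLemma)

    prime∤factorial : ∀ {j} → j < p → ¬ p ∣ j !
    prime∤factorial {zero}  _   p∣1 with () ← <⇒≱ (nonTrivial⇒n>1 p) (∣⇒≤ p∣1)
      where open import Data.Nat.Base using (nonTrivial⇒n>1)
    prime∤factorial {suc j} j<p p∣j! with euclidsLemma (suc j) (j !) p-prime p∣j!
    ... | inj₁ p∣1+j = <⇒≱ j<p (∣⇒≤ p∣1+j)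
    ... | inj₂ p∣j!  = prime∤factorial (<-trans (n<1+n j) j<p) p∣j!

    prime∣binomial : ∀ {k} → 0 < k → k < p → p ∣ p C k
    prime∣binomial {k} 0<k k<p with euclidsLemma (p C k) (k ! * (p ∸ k) !) p-prime p∣C*k!*[p-k]!
      where
      instance _ = k !* (p ∸ k) !≢0
      C*k!*[p-k]!≡p! : (p C k) * (k ! * (p ∸ k) !) ≡ p !
      C*k!*[p-k]!≡p! = trans (cong (_* (k ! * (p ∸ k) !)) (nCk≡n!/k![n-k]! (<⇒≤ k<p)))
                             (m/n*n≡m (k![n∸k]!∣n! (<⇒≤ k<p)))
      n∣n! : ∀ n .{{_ : NonZero n}} → n ∣ n !
      n∣n! (suc n) = m∣m*n (n !)
      p∣C*k!*[p-k]! : p ∣ (p C k) * (k ! * (p ∸ k) !)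
      p∣C*k!*[p-k]! = subst (p ∣_) (sym C*k!*[p-k]!≡p!) (n∣n! p {{prime⇒nonZero p-prime}})
    ... | inj₁ p∣C = p∣C
    ... | inj₂ p∣k!*[p-k]! with euclidsLemma (k !) ((p ∸ k) !) p-prime p∣k!*[p-k]!
    ...   | inj₁ p∣k!     = ⊥-elim (prime∤factorial k<p p∣k!)
    ...   | inj₂ p∣[p-k]! = ⊥-elim (prime∤factorial (∸-monoʳ-< 0<k (<⇒≤ k<p)) p∣[p-k]!)

  coprime-divisors : ∀ {a b c d} → Coprime a b → c ∣ a → d ∣ b → Coprime c d
  coprime-divisors a⊥b c∣a d∣b (i∣c , i∣d) = a⊥b (∣-trans i∣c c∣a , ∣-trans i∣d d∣b)

  gcd≤1⇒coprime : ∀ {a b} .{{_ : NonZero b}} → gcd a b ≤ 1 → Coprime a b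
  gcd≤1⇒coprime {a} {b} gcd≤1 =
    gcd≡1⇒coprime (≤-antisym gcd≤1 (n≢0⇒n>0 (gcd[m,n]≢0 a b (inj₂ (≢-nonZero⁻¹ b)))))

  m≤⌈m/n⌉*n : ∀ a b → a ≤ ceilDiv a (suc b) * suc b
  m≤⌈m/n⌉*n a b = +-cancelʳ-≤ b a _ (begin
    a + b                                          ≡⟨ m≡m%n+[m/n]*n (a + b) (suc b) ⟩
    (a + b) % suc b + ceilDiv a (suc b) * suc b    ≤⟨ +-monoˡ-≤ _ (s≤s⁻¹ (m%n<n (a + b) (suc b))) ⟩
    b + ceilDiv a (suc b) * suc b                  ≡⟨ +-comm b _ ⟩
    ceilDiv a (suc b) * suc b + b                  ∎)
    where open ≤-Reasoning

open Arithmetic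

tail-++ : ∀ {a} {A : Set a} {m n} (xs : Vector A (suc m)) (ys : Vector A n) → tail (xs ++ ys) ≗ tail xs ++ ys
tail-++ {m = m} xs ys i with Fin.splitAt m i
... | inj₁ _ = ≡.refl
... | inj₂ _ = ≡.refl

¬¬-Fin-∀ : ∀ {a n} {P : Fin n → Set a} → (∀ i → ¬ ¬ P i) → ¬ ¬ (∀ i → P i)
¬¬-Fin-∀ {n = zero}  _   ¬∀P = ¬∀P λ ()
¬¬-Fin-∀ {n = suc n} ¬¬P ¬∀P = ¬¬P Fin.zero λ P₀ → ¬¬-Fin-∀ (¬¬P ∘ Fin.suc) λ Pₛ →
  ¬∀P λ { Fin.zero → P₀ ; (Fin.suc i) → Pₛ i }

module RingFacts {c ℓ} (R : CommutativeRing c ℓ) where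

  open CommutativeRing R
  open RingOps R
  open import Algebra.Properties.Semiring.Exp semiring using (_^_; ^-congˡ; ^-homo-*; ^-assocʳ)
  open import Algebra.Properties.CommutativeSemiring.Exp commutativeSemiring using (^-distrib-*)
  open import Algebra.Properties.Semiring.Mult semiring
    using (×-homo-+; ×1-homo-*; ×-assoc-*; ×-congʳ) renaming (_×_ to _×ᵣ_)
  open import Algebra.Properties.Monoid.Sum +-monoid
    using (sum; sum-init-last; sum-cong-≗; sum-cong-≋; sum-replicate; sum-replicate-zero)
  open import Algebra.Properties.Semiring.Sum semiring using (*-distribˡ-sum)
  import Algebra.Properties.CommutativeSemiring.Binomial commutativeSemiring as Binomial
  open Binomial using (binomialTerm)
  open import Data.Fin.Properties using (toℕ-fromℕ; toℕ-inject₁; toℕ<n)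
  open import Data.Nat.Combinatorics using (nCn≡1)
  open import Algebra.Solver.Ring.NaturalCoefficients.Default commutativeSemiring
    using (solve; _:=_; _:+_; _:*_; con)
  open import Data.Nat.Coprimality using (coprime-Bézout)
  open import Data.Nat.GCD using (module Bézout)
  open import Relation.Binary.Reasoning.Setoid setoid

  pow≡^ : ∀ x n → pow x n ≡ x ^ n
  pow≡^ x zero    = ≡.refl
  pow≡^ x (suc n) = ≡.cong (x *_) (pow≡^ x n)

  pow-cong : ∀ {x y} n → x ≈ y → pow x n ≈ pow y n
  pow-cong {x} {y} n x≈y rewrite pow≡^ x n | pow≡^ y n = ^-congˡ n x≈y

  pow-+ : ∀ x m n → pow x (m ℕ.+ n) ≈ pow x m * pow x n
  pow-+ x m n rewrite pow≡^ x (m ℕ.+ n) | pow≡^ x m | pow≡^ x n = ^-homo-* x m n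

  pow-* : ∀ x m n → pow x (m ℕ.* n) ≈ pow (pow x m) n
  pow-* x m n rewrite pow≡^ x (m ℕ.* n) | pow≡^ (pow x m) n | pow≡^ x m = sym (^-assocʳ x m n)

  pow-distrib-* : ∀ x y n → pow (x * y) n ≈ pow x n * pow y n
  pow-distrib-* x y n rewrite pow≡^ (x * y) n | pow≡^ x n | pow≡^ y n = ^-distrib-* x y n

  pow-1# : ∀ n → pow 1# n ≈ 1#
  pow-1# zero    = refl
  pow-1# (suc n) = trans (*-identityˡ _) (pow-1# n)

  pow-pow-comm : ∀ x m n → pow (pow x m) n ≈ pow (pow x n) m
  pow-pow-comm x m n = begin
    pow (pow x m) n    ≈⟨ pow-* x m n ⟨
    pow x (m ℕ.* n)    ≡⟨ ≡.cong (pow x) (ℕₚ.*-comm m n) ⟩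
    pow x (n ℕ.* m)    ≈⟨ pow-* x n m ⟩
    pow (pow x n) m    ∎

  pow-of-root : ∀ {x m} k → pow x m ≈ 1# → pow (pow x k) m ≈ 1#
  pow-of-root {x} {m} k xᵐ≈1 = begin
    pow (pow x k) m    ≈⟨ pow-pow-comm x k m ⟩
    pow (pow x m) k    ≈⟨ pow-cong k xᵐ≈1 ⟩
    pow 1# k           ≈⟨ pow-1# k ⟩
    1#                 ∎

  pow-0# : ∀ n .{{_ : ℕ.NonZero n}} → pow 0# n ≈ 0#
  pow-0# (suc n) = zeroˡ _

  root-of-divisor : ∀ {x d n} → pow x d ≈ 1# → d ∣ n → pow x n ≈ 1#
  root-of-divisor {x} {d} xᵈ≈1 (divides k ≡.refl) = begin
    pow x (k ℕ.* d)    ≡⟨ ≡.cong (pow x) (ℕₚ.*-comm k d) ⟩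
    pow x (d ℕ.* k)    ≈⟨ pow-* x d k ⟩
    pow (pow x d) k    ≈⟨ pow-cong k xᵈ≈1 ⟩
    pow 1# k           ≈⟨ pow-1# k ⟩
    1#                 ∎

  pow-coprime≉1 : ∀ {x m j} → pow x m ≈ 1# → ¬ x ≈ 1# → Coprime j m → ¬ pow x j ≈ 1#
  pow-coprime≉1 {x} {m} {j} xᵐ≈1 x≉1 j⊥m xʲ≈1 with coprime-Bézout j⊥m
  ... | Bézout.+- a b 1+bm≡aj = x≉1 (begin
    x                     ≈⟨ *-identityʳ x ⟨
    x * 1#                ≈⟨ *-congˡ (root-of-divisor xᵐ≈1 (divides b ≡.refl)) ⟨
    pow x (1 ℕ.+ b ℕ.* m) ≡⟨ ≡.cong (pow x) 1+bm≡aj ⟩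
    pow x (a ℕ.* j)       ≈⟨ root-of-divisor xʲ≈1 (divides a ≡.refl) ⟩
    1#                    ∎)
  ... | Bézout.-+ a b 1+aj≡bm = x≉1 (begin
    x                     ≈⟨ *-identityʳ x ⟨
    x * 1#                ≈⟨ *-congˡ (root-of-divisor xʲ≈1 (divides a ≡.refl)) ⟨
    pow x (1 ℕ.+ a ℕ.* j) ≡⟨ ≡.cong (pow x) 1+aj≡bm ⟩
    pow x (b ℕ.* m)       ≈⟨ root-of-divisor xᵐ≈1 (divides b ≡.refl) ⟩
    1#                    ∎)

  natCast≡× : ∀ n → natCast n ≡ n ×ᵣ 1#
  natCast≡× zero    = ≡.refl
  natCast≡× (suc n) = ≡.cong (1# +_) (natCast≡× n)

  natCast-+ : ∀ m n → natCast (m ℕ.+ n) ≈ natCast m + natCast n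
  natCast-+ m n rewrite natCast≡× (m ℕ.+ n) | natCast≡× m | natCast≡× n = ×-homo-+ 1# m n

  natCast-* : ∀ m n → natCast (m ℕ.* n) ≈ natCast m * natCast n
  natCast-* m n rewrite natCast≡× (m ℕ.* n) | natCast≡× m | natCast≡× n = ×1-homo-* m n

  sum-toℕ-last : ∀ n (f : ℕ → Carrier) → sum {suc n} (f ∘ toℕ) ≈ sum {n} (f ∘ toℕ) + f n
  sum-toℕ-last n f = begin
    sum {suc n} (f ∘ toℕ)
      ≈⟨ sum-init-last {n} (f ∘ toℕ) ⟩
    sum {n} (f ∘ toℕ ∘ Fin.inject₁) + f (toℕ (Fin.fromℕ n))
      ≡⟨ ≡.cong₂ _+_ (sum-cong-≗ {n} (≡.cong f ∘ toℕ-inject₁)) (≡.cong f (toℕ-fromℕ n)) ⟩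
    sum {n} (f ∘ toℕ) + f n
      ∎

  sum-rotate : ∀ n (f : ℕ → Carrier) → f n ≈ f 0 → sum {n} (f ∘ suc ∘ toℕ) ≈ sum {n} (f ∘ toℕ)
  sum-rotate zero    f _        = refl
  sum-rotate (suc n) f fₙ≈f₀ = begin
    sum {suc n} (f ∘ suc ∘ toℕ)            ≈⟨ sum-toℕ-last n (f ∘ suc) ⟩
    sum {n} (f ∘ suc ∘ toℕ) + f (suc n)    ≈⟨ +-congˡ fₙ≈f₀ ⟩
    sum {n} (f ∘ suc ∘ toℕ) + f 0          ≈⟨ +-comm _ (f 0) ⟩
    f 0 + sum {n} (f ∘ suc ∘ toℕ)          ∎

  sum-++ : ∀ a {b} (α : Fin a → Carrier) (β : Fin b → Carrier) → sum (α ++ β) ≈ sum α + sum β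
  sum-++ zero    α β = sym (+-identityˡ (sum β))
  sum-++ (suc a) α β = begin
    α Fin.zero + sum (tail (α ++ β))               ≡⟨ ≡.cong (α Fin.zero +_) (sum-cong-≗ (tail-++ α β)) ⟩
    α Fin.zero + sum ((α ∘ Fin.suc) ++ β)          ≈⟨ +-congˡ (sum-++ a (α ∘ Fin.suc) β) ⟩
    α Fin.zero + (sum (α ∘ Fin.suc) + sum β)       ≈⟨ +-assoc _ _ _ ⟨
    sum α + sum β                                  ∎

  geometric : Carrier → ℕ → Carrier
  geometric w n = sum {n} λ k → pow w (toℕ k)

  geometric-suc : ∀ w n → geometric w (suc n) ≈ 1# + w * geometric w n
  geometric-suc w n = +-congˡ (sym (*-distribˡ-sum {n} w λ k → pow w (toℕ k)))

  geometric-telescope : ∀ w n → w * geometric w n + 1# ≈ geometric w n + pow w n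
  geometric-telescope w n = begin
    w * geometric w n + 1#     ≈⟨ +-comm _ 1# ⟩
    1# + w * geometric w n     ≈⟨ geometric-suc w n ⟨
    geometric w (suc n)        ≈⟨ sum-toℕ-last n (pow w) ⟩
    geometric w n + pow w n    ∎

  geometric-cong : ∀ {v w} n → v ≈ w → geometric v n ≈ geometric w n
  geometric-cong n v≈w = sum-cong-≋ {n} λ k → pow-cong (toℕ k) v≈w

  geometric-1# : ∀ n → geometric 1# n ≈ natCast n
  geometric-1# n = begin
    geometric 1# n              ≈⟨ sum-cong-≋ {n} (λ k → pow-1# (toℕ k)) ⟩
    sum {n} (λ _ → 1#)          ≈⟨ sum-replicate n ⟩
    n ×ᵣ 1#                     ≡⟨ natCast≡× n ⟨
    natCast n                   ∎

  sum-concentrated-at-0 : ∀ n .{{_ : ℕ.NonZero n}} (f : ℕ → Carrier) →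
                          (∀ {i} → 0 < i → i < n → f i ≈ 0#) → sum {n} (f ∘ toℕ) ≈ f 0
  sum-concentrated-at-0 (suc n) f f≈0 = begin
    f 0 + sum {n} (f ∘ suc ∘ toℕ)    ≈⟨ +-congˡ (sum-cong-≋ {n} λ i → f≈0 ℕ.z<s (ℕ.s≤s (toℕ<n i))) ⟩
    f 0 + sum {n} (λ _ → 0#)         ≈⟨ +-congˡ (sum-replicate-zero n) ⟩
    f 0 + 0#                         ≈⟨ +-identityʳ (f 0) ⟩
    f 0                              ∎

  eval-ones : ∀ n w → eval (replicate n 1#) w ≈ geometric w n
  eval-ones zero    w = refl
  eval-ones (suc n) w = trans (+-congˡ (*-congˡ (eval-ones n w))) (sym (geometric-suc w n))

  evalMonic : List Carrier → Carrier → Carrier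
  evalMonic []       x = 1#
  evalMonic (c ∷ cs) x = c + x * evalMonic cs x

  evalMonic-zeros : ∀ n x → evalMonic (replicate n 0#) x ≈ pow x n
  evalMonic-zeros zero    x = refl
  evalMonic-zeros (suc n) x = trans (+-identityˡ _) (*-congˡ (evalMonic-zeros n x))

  divideByRoot : Carrier → List Carrier → List Carrier
  divideByRoot a []           = []
  divideByRoot a (c ∷ [])     = []
  divideByRoot a (c ∷ d ∷ ds) = evalMonic (d ∷ ds) a ∷ divideByRoot a (d ∷ ds)

  length-divideByRoot : ∀ a c cs → length (divideByRoot a (c ∷ cs)) ≡ length cs
  length-divideByRoot a c []       = ≡.refl
  length-divideByRoot a c (d ∷ ds) = ≡.cong suc (length-divideByRoot a d ds)

  -- f(x) − f(a) = (x − a) q(x), with both sides moved so that no subtraction occurs.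
  synthetic-division : ∀ a x c cs → let f = c ∷ cs; q = divideByRoot a f in
                       evalMonic f x + a * evalMonic q x ≈ evalMonic f a + x * evalMonic q x
  synthetic-division a x c [] =
    solve 3 (λ c x a → (c :+ x :* con 1) :+ a :* con 1 := (c :+ a :* con 1) :+ x :* con 1) refl c x a
  synthetic-division a x c (d ∷ ds) = begin
    (c + x * g) + a * (gₐ + x * q)
      ≈⟨ solve 6 (λ c x g a gₐ q → (c :+ x :* g) :+ a :* (gₐ :+ x :* q)
                                  := (c :+ a :* gₐ) :+ x :* (g :+ a :* q)) refl c x g a gₐ q ⟩
    (c + a * gₐ) + x * (g + a * q)
      ≈⟨ +-congˡ (*-congˡ (synthetic-division a x d ds)) ⟩
    (c + a * gₐ) + x * (gₐ + x * q)
      ∎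
    where
    g gₐ q : Carrier
    g  = evalMonic (d ∷ ds) x
    gₐ = evalMonic (d ∷ ds) a
    q  = evalMonic (divideByRoot a (d ∷ ds)) x

  module _ (x y : Carrier) where

    binomialTerm≈ : ∀ n k → binomialTerm x y n k ≈ natCast (n C toℕ k) * (x ^ toℕ k * y ^ (n ℕ.∸ toℕ k))
    binomialTerm≈ n k = sym (begin
      natCast (n C toℕ k) * b      ≡⟨ ≡.cong (_* b) (natCast≡× (n C toℕ k)) ⟩
      (n C toℕ k) ×ᵣ 1# * b        ≈⟨ ×-assoc-* (n C toℕ k) 1# b ⟩
      (n C toℕ k) ×ᵣ (1# * b)      ≈⟨ ×-congʳ (n C toℕ k) (*-identityˡ b) ⟩
      binomialTerm x y n k         ∎)
      where
      b : Carrier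
      b = x ^ toℕ k * y ^ (n ℕ.∸ toℕ k)

    binomialTerm-first : ∀ n → binomialTerm x y n Fin.zero ≈ pow y n
    binomialTerm-first n = begin
      binomialTerm x y n Fin.zero  ≈⟨ binomialTerm≈ n Fin.zero ⟩
      (1# + 0#) * (1# * y ^ n)     ≈⟨ *-congʳ (+-identityʳ 1#) ⟩
      1# * (1# * y ^ n)            ≈⟨ trans (*-identityˡ _) (*-identityˡ _) ⟩
      y ^ n                        ≡⟨ pow≡^ y n ⟨
      pow y n                      ∎

    binomialTerm-last : ∀ n → binomialTerm x y n (Fin.fromℕ n) ≈ pow x n
    binomialTerm-last n = begin
      binomialTerm x y n (Fin.fromℕ n)
        ≈⟨ binomialTerm≈ n (Fin.fromℕ n) ⟩
      natCast (n C toℕ (Fin.fromℕ n)) * (x ^ toℕ (Fin.fromℕ n) * y ^ (n ℕ.∸ toℕ (Fin.fromℕ n)))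
        ≡⟨ ≡.cong (λ i → natCast (n C i) * (x ^ i * y ^ (n ℕ.∸ i))) (toℕ-fromℕ n) ⟩
      natCast (n C n) * (x ^ n * y ^ (n ℕ.∸ n))
        ≡⟨ ≡.cong₂ (λ C e → natCast C * (x ^ n * y ^ e)) (nCn≡1 n) (ℕₚ.n∸n≡0 n) ⟩
      (1# + 0#) * (x ^ n * 1#)
        ≈⟨ *-congʳ (+-identityʳ 1#) ⟩
      1# * (x ^ n * 1#)
        ≈⟨ trans (*-identityˡ _) (*-identityʳ _) ⟩
      x ^ n
        ≡⟨ pow≡^ x n ⟨
      pow x n
        ∎

  freshmans-dream : ∀ n .{{_ : ℕ.NonZero n}} → (∀ {k} → 0 < k → k < n → natCast (n C k) ≈ 0#) →
                    ∀ x y → pow (x + y) n ≈ pow x n + pow y n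
  freshmans-dream n@(suc n-1) C≈0 x y = begin
    pow (x + y) n
      ≡⟨ pow≡^ (x + y) n ⟩
    (x + y) ^ n
      ≈⟨ Binomial.theorem n x y ⟩
    term Fin.zero + sum (term ∘ Fin.suc)
      ≈⟨ +-congˡ (sum-init-last (term ∘ Fin.suc)) ⟩
    term Fin.zero + (sum middle + term (Fin.fromℕ n))
      ≈⟨ +-cong (binomialTerm-first x y n) (+-cong middle≈0 (binomialTerm-last x y n)) ⟩
    pow y n + (0# + pow x n)
      ≈⟨ +-congˡ (+-identityˡ (pow x n)) ⟩
    pow y n + pow x n
      ≈⟨ +-comm (pow y n) (pow x n) ⟩
    pow x n + pow y n
      ∎
    where
    term : Fin (suc n) → Carrier
    term = binomialTerm x y n
    middle : Fin n-1 → Carrier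
    middle k = term (Fin.suc (Fin.inject₁ k))
    inject₁<n-1 : ∀ k → toℕ (Fin.inject₁ k) ℕ.< n-1
    inject₁<n-1 k = ≡.subst (ℕ._< n-1) (≡.sym (toℕ-inject₁ k)) (toℕ<n k)
    middle≈0 : sum middle ≈ 0#
    middle≈0 = begin
      sum middle               ≈⟨ sum-cong-≋ {n-1} (λ k → trans (binomialTerm≈ x y n (Fin.suc (Fin.inject₁ k)))
                                    (trans (*-congʳ (C≈0 ℕ.z<s (ℕ.s≤s (inject₁<n-1 k)))) (zeroˡ _))) ⟩
      sum {n-1} (λ _ → 0#)     ≈⟨ sum-replicate-zero n-1 ⟩
      0#                       ∎

module FieldFacts {c ℓ p} (K : ACField c ℓ p) where

  open ACField K
  open RingFacts cring
  open import Algebra.Properties.Ring ring using ([y-z]x≈yx-zx)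
  open import Algebra.Properties.Monoid.Sum +-monoid using (sum)
  open import Algebra.Properties.AbelianGroup +-abelianGroup
    using (x∙y⁻¹≈ε⇒x≈y; x≈y⇒x∙y⁻¹≈ε) renaming (∙-cancelʳ to +-cancelʳ)
  open import Data.Nat using (z≤n; s≤s)
  open import Relation.Binary.Reasoning.Setoid setoid

  *≈0⇒≈0 : ∀ {a b} → ¬ a ≈ 0# → a * b ≈ 0# → b ≈ 0#
  *≈0⇒≈0 {a} {b} a≉0 ab≈0 with a⁻¹ , aa⁻¹≈1 ← inverse a a≉0 = begin
    b                ≈⟨ *-identityˡ b ⟨
    1# * b           ≈⟨ *-congʳ (trans (*-comm a⁻¹ a) aa⁻¹≈1) ⟨
    (a⁻¹ * a) * b    ≈⟨ *-assoc a⁻¹ a b ⟩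
    a⁻¹ * (a * b)    ≈⟨ *-congˡ ab≈0 ⟩
    a⁻¹ * 0#         ≈⟨ zeroʳ a⁻¹ ⟩
    0#               ∎

  x*a≈y*a⇒a≈0 : ∀ {x y a} → ¬ x ≈ y → x * a ≈ y * a → a ≈ 0#
  x*a≈y*a⇒a≈0 {x} {y} {a} x≉y xa≈ya = *≈0⇒≈0 (x≉y ∘ x∙y⁻¹≈ε⇒x≈y x y) (begin
    (x - y) * a      ≈⟨ [y-z]x≈yx-zx a x y ⟩
    x * a - y * a    ≈⟨ x≈y⇒x∙y⁻¹≈ε xa≈ya ⟩
    0#               ∎)

  geometric-vanishes : ∀ {w n} → pow w n ≈ 1# → ¬ w ≈ 1# → geometric w n ≈ 0#
  geometric-vanishes {w} {n} wⁿ≈1 w≉1 = x*a≈y*a⇒a≈0 w≉1 (+-cancelʳ 1# _ _ (begin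
    w * geometric w n + 1#     ≈⟨ geometric-telescope w n ⟩
    geometric w n + pow w n    ≈⟨ +-congˡ wⁿ≈1 ⟩
    geometric w n + 1#         ≈⟨ +-congʳ (*-identityˡ _) ⟨
    1# * geometric w n + 1#    ∎))

  sumFin≡sum : ∀ n f → sumFin K n f ≡ sum {n} f
  sumFin≡sum zero    f = ≡.refl
  sumFin≡sum (suc n) f = ≡.cong (f Fin.zero +_) (sumFin≡sum n (f ∘ Fin.suc))

  trace≈sum : ∀ e x → trace K e x ≈ sum {e} (λ i → pow x (p ℕ.^ toℕ i))
  trace≈sum zero    x = refl
  trace≈sum (suc e) x = begin
    conjugate e + trace K e x                  ≈⟨ +-congˡ (trace≈sum e x) ⟩
    conjugate e + sum {e} (conjugate ∘ toℕ)    ≈⟨ +-comm _ _ ⟩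
    sum {e} (conjugate ∘ toℕ) + conjugate e    ≈⟨ sum-toℕ-last e conjugate ⟨
    sum {suc e} (conjugate ∘ toℕ)              ∎
    where
    conjugate : ℕ → Carrier
    conjugate i = pow x (p ℕ.^ i)

  trace-1# : ∀ e → trace K e 1# ≈ natCast e
  trace-1# zero    = refl
  trace-1# (suc e) = +-cong (pow-1# (p ℕ.^ e)) (trace-1# e)

  monic-root-bound : ∀ n cs → length cs ≡ n → (r : ℕ → Carrier) →
                     (∀ {i j} → i < j → j ≤ n → ¬ r i ≈ r j) →
                     ¬ (∀ {i} → i ≤ n → evalMonic cs (r i) ≈ 0#)
  monic-root-bound n       []       _        r distinct roots = 1≉0 (roots z≤n)
  monic-root-bound (suc n) (c ∷ cs) ≡.refl   r distinct roots =
    monic-root-bound n (divideByRoot (r 0) (c ∷ cs)) (length-divideByRoot (r 0) c cs) (r ∘ suc)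
      (λ i<j j≤n → distinct (s≤s i<j) (s≤s j≤n)) quotient-roots
    where
    quotient-roots : ∀ {i} → i ≤ n → evalMonic (divideByRoot (r 0) (c ∷ cs)) (r (suc i)) ≈ 0#
    quotient-roots {i} i≤n = x*a≈y*a⇒a≈0 (distinct (s≤s z≤n) (s≤s i≤n)) (+-cancelʳ (f (r 0)) _ _ (begin
      r 0 * q + f (r 0)          ≈⟨ +-congˡ (roots z≤n) ⟩
      r 0 * q + 0#               ≈⟨ +-congˡ (roots (s≤s i≤n)) ⟨
      r 0 * q + f (r (suc i))    ≈⟨ +-comm _ _ ⟩
      f (r (suc i)) + r 0 * q    ≈⟨ synthetic-division (r 0) (r (suc i)) c cs ⟩
      f (r 0) + r (suc i) * q    ≈⟨ +-comm _ _ ⟩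
      r (suc i) * q + f (r 0)    ∎))
      where
      f : Carrier → Carrier
      f = evalMonic (c ∷ cs)
      q : Carrier
      q = evalMonic (divideByRoot (r 0) (c ∷ cs)) (r (suc i))


module CharacteristicP {c ℓ p} (K : ACField c ℓ p) (p-prime : Prime p) where

  open ACField K
  open RingFacts cring
  open FieldFacts K
  open import Algebra.Properties.AbelianGroup +-abelianGroup using () renaming (∙-cancelˡ to +-cancelˡ)
  open import Algebra.Properties.Monoid.Sum +-monoid using (sum; sum-cong-≋)
  open import Data.Nat using (s≤s)
  open import Data.Nat.Coprimality using (coprime-Bézout; prime⇒coprime)
  import Data.Nat.Coprimality as Coprimality
  open import Data.Nat.GCD using (module Bézout)
  open import Relation.Binary.Reasoning.Setoid setoid

  private instance
    p≢0 : NonZero p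
    p≢0 = prime⇒nonZero p-prime

  open Residues p using (_≡ₘ_; mod-≡)

  natCast-multiple : ∀ k → natCast (k ℕ.* p) ≈ 0#
  natCast-multiple k = begin
    natCast (k ℕ.* p)        ≈⟨ natCast-* k p ⟩
    natCast k * natCast p    ≈⟨ *-congˡ char ⟩
    natCast k * 0#           ≈⟨ zeroʳ (natCast k) ⟩
    0#                       ∎

  natCast-% : ∀ n → natCast (n % p) ≈ natCast n
  natCast-% n = begin
    natCast (n % p)                              ≈⟨ +-identityʳ _ ⟨
    natCast (n % p) + 0#                         ≈⟨ +-congˡ (natCast-multiple (n / p)) ⟨
    natCast (n % p) + natCast (n / p ℕ.* p)      ≈⟨ natCast-+ (n % p) (n / p ℕ.* p) ⟨
    natCast (n % p ℕ.+ n / p ℕ.* p)              ≡⟨ ≡.cong natCast (m≡m%n+[m/n]*n n p) ⟨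
    natCast n                                    ∎

  natCast-≡ₘ : ∀ {a b} → a ≡ₘ b → natCast a ≈ natCast b
  natCast-≡ₘ {a} {b} (mod-≡ a%p≡b%p) = begin
    natCast a          ≈⟨ natCast-% a ⟨
    natCast (a % p)    ≡⟨ ≡.cong natCast a%p≡b%p ⟩
    natCast (b % p)    ≈⟨ natCast-% b ⟩
    natCast b          ∎

  natCast-coprime≉0 : ∀ {n} → Coprime n p → ¬ natCast n ≈ 0#
  natCast-coprime≉0 {n} n⊥p n≈0 = 1≉0 (1≈0 (coprime-Bézout n⊥p))
    where
    multiple≈0 : ∀ x → natCast (x ℕ.* n) ≈ 0#
    multiple≈0 x = trans (natCast-* x n) (trans (*-congˡ n≈0) (zeroʳ _))
    1≈0 : Bézout.Identity 1 n p → 1# ≈ 0#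
    1≈0 (Bézout.+- x y 1+yp≡xn) = begin
      1#                          ≈⟨ +-identityʳ 1# ⟨
      1# + 0#                     ≈⟨ +-congˡ (natCast-multiple y) ⟨
      natCast (1 ℕ.+ y ℕ.* p)     ≡⟨ ≡.cong natCast 1+yp≡xn ⟩
      natCast (x ℕ.* n)           ≈⟨ multiple≈0 x ⟩
      0#                          ∎
    1≈0 (Bézout.-+ x y 1+xn≡yp) = begin
      1#                          ≈⟨ +-identityʳ 1# ⟨
      1# + 0#                     ≈⟨ +-congˡ (multiple≈0 x) ⟨
      natCast (1 ℕ.+ x ℕ.* n)     ≡⟨ ≡.cong natCast 1+xn≡yp ⟩
      natCast (y ℕ.* p)           ≈⟨ natCast-multiple y ⟩
      0#                          ∎

  natCast-injective : ∀ {a b} → a < b → b < p → ¬ natCast a ≈ natCast b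
  natCast-injective {a} {b} a<b b<p a≈b = natCast-coprime≉0 b-a⊥p (+-cancelˡ (natCast a) _ _ (begin
    natCast a + natCast (b ℕ.∸ a)    ≈⟨ natCast-+ a (b ℕ.∸ a) ⟨
    natCast (a ℕ.+ (b ℕ.∸ a))        ≡⟨ ≡.cong natCast (m+[n∸m]≡n (<⇒≤ a<b)) ⟩
    natCast b                        ≈⟨ a≈b ⟨
    natCast a                        ≈⟨ +-identityʳ _ ⟨
    natCast a + 0#                   ∎))
    where
    open import Data.Nat.Properties using (m+[n∸m]≡n; <⇒≤; m<n⇒0<n∸m; m∸n≤m; ≤-<-trans)
    b-a⊥p : Coprime (b ℕ.∸ a) p
    b-a⊥p = Coprimality.sym (prime⇒coprime p-prime {{ℕ.>-nonZero (m<n⇒0<n∸m a<b)}}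
                                                     (≤-<-trans (m∸n≤m b a) b<p))

  frobenius : ∀ x y → pow (x + y) p ≈ pow x p + pow y p
  frobenius = freshmans-dream p λ 0<k k<p →
    let divides q p-C-k≡q*p = prime∣binomial p-prime 0<k k<p in
    trans (reflexive (≡.cong natCast p-C-k≡q*p)) (natCast-multiple q)

  fermat : ∀ k → pow (natCast k) p ≈ natCast k
  fermat zero    = pow-0# p
  fermat (suc k) = begin
    pow (1# + natCast k) p         ≈⟨ frobenius 1# (natCast k) ⟩
    pow 1# p + pow (natCast k) p   ≈⟨ +-cong (pow-1# p) (fermat k) ⟩
    1# + natCast k                 ∎

  Xᵖ-X : List Carrier
  Xᵖ-X = 0# ∷ - 1# ∷ replicate (p ℕ.∸ 2) 0#

  2+[p-2]≡p : 2 ℕ.+ (p ℕ.∸ 2) ≡ p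
  2+[p-2]≡p = ℕₚ.m+[n∸m]≡n (ℕ.nonTrivial⇒n>1 p {{prime⇒nonTrivial p-prime}})
    where open import Data.Nat.Primality using (prime⇒nonTrivial)

  length-Xᵖ-X : length Xᵖ-X ≡ p
  length-Xᵖ-X = ≡.trans (≡.cong (suc ∘ suc) (length-replicate (p ℕ.∸ 2))) 2+[p-2]≡p
    where open import Data.List.Properties using (length-replicate)

  Xᵖ-X-root : ∀ {y} → pow y p ≈ y → evalMonic Xᵖ-X y ≈ 0#
  Xᵖ-X-root {y} yᵖ≈y = begin
    0# + y * (- 1# + y * evalMonic (replicate (p ℕ.∸ 2) 0#) y)
      ≈⟨ +-identityˡ _ ⟩
    y * (- 1# + y * evalMonic (replicate (p ℕ.∸ 2) 0#) y)
      ≈⟨ *-congˡ (+-congˡ (*-congˡ (evalMonic-zeros (p ℕ.∸ 2) y))) ⟩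
    y * (- 1# + y * pow y (p ℕ.∸ 2))
      ≈⟨ distribˡ y (- 1#) _ ⟩
    y * - 1# + pow y (2 ℕ.+ (p ℕ.∸ 2))
      ≡⟨ ≡.cong (λ n → y * - 1# + pow y n) 2+[p-2]≡p ⟩
    y * - 1# + pow y p
      ≈⟨ +-cong (sym (-‿distribʳ-* y 1#)) yᵖ≈y ⟩
    - (y * 1#) + y
      ≈⟨ +-congʳ (-‿cong (*-identityʳ y)) ⟩
    - y + y
      ≈⟨ -‿inverseˡ y ⟩
    0#
      ∎
    where open import Algebra.Properties.Ring ring using (-‿distribʳ-*)

  -- Otherwise x, 0, 1, …, p − 1 would be p + 1 distinct roots of X^p − X.  Equality in K is not
  -- decidable, so this only refutes x ∉ 𝔽_p.
  frobenius-fixed⇒∈Fp : ∀ {x} → pow x p ≈ x → ¬ ¬ InFp K x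
  frobenius-fixed⇒∈Fp {x} xᵖ≈x x∉Fp = monic-root-bound p Xᵖ-X length-Xᵖ-X r distinct roots
    where
    r : ℕ → Carrier
    r zero    = x
    r (suc i) = natCast i

    distinct : ∀ {i j} → i < j → j ≤ p → ¬ r i ≈ r j
    distinct {zero}  {suc j} _         _   x≈j = x∉Fp (j , x≈j)
    distinct {suc i} {suc j} (s≤s i<j) j<p     = natCast-injective i<j j<p

    roots : ∀ {i} → i ≤ p → evalMonic Xᵖ-X (r i) ≈ 0#
    roots {zero}  _ = Xᵖ-X-root xᵖ≈x
    roots {suc i} _ = Xᵖ-X-root (fermat i)

  frobenius-sum : ∀ n (f : Fin n → Carrier) → pow (sum f) p ≈ sum (λ i → pow (f i) p)
  frobenius-sum zero    f = pow-0# p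
  frobenius-sum (suc n) f = trans (frobenius (f Fin.zero) _) (+-congˡ (frobenius-sum n (f ∘ Fin.suc)))

  trace-frobenius-fixed : ∀ e {h} → pow h (p ℕ.^ e) ≈ h → pow (trace K e h) p ≈ trace K e h
  trace-frobenius-fixed e {h} h∈L = begin
    pow (trace K e h) p                           ≈⟨ pow-cong p (trace≈sum e h) ⟩
    pow (sum {e} (conjugate ∘ toℕ)) p             ≈⟨ frobenius-sum e (conjugate ∘ toℕ) ⟩
    sum {e} (λ i → pow (conjugate (toℕ i)) p)     ≈⟨ sum-cong-≋ {e} (λ i → sym (next-conjugate (toℕ i))) ⟩
    sum {e} (conjugate ∘ suc ∘ toℕ)               ≈⟨ sum-rotate e conjugate (trans h∈L (sym (*-identityʳ h))) ⟩
    sum {e} (conjugate ∘ toℕ)                     ≈⟨ trace≈sum e h ⟨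
    trace K e h                                   ∎
    where
    conjugate : ℕ → Carrier
    conjugate i = pow h (p ℕ.^ i)
    next-conjugate : ∀ i → conjugate (suc i) ≈ pow (conjugate i) p
    next-conjugate i = trans (reflexive (≡.cong (pow h) (ℕₚ.*-comm p (p ℕ.^ i)))) (pow-* h (p ℕ.^ i) p)

module SumsOfRoots {c ℓ p} (K : ACField c ℓ p) (m : ℕ) where

  open ACField K
  open RingFacts cring
  open FieldFacts K using (sumFin≡sum)
  open import Algebra.Properties.Monoid.Sum +-monoid using (sum)
  open import Relation.Binary.Reasoning.Setoid setoid

  SumOfRoots : ℕ → Carrier → Set (c ⊔ ℓ)
  SumOfRoots n s = Σ (Fin n → Carrier) λ α → (∀ i → pow (α i) m ≈ 1#) × sumFin K n α ≈ s

  SumOfRoots-cong : ∀ {n s t} → s ≈ t → SumOfRoots n s → SumOfRoots n t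
  SumOfRoots-cong s≈t (α , α-roots , Σα≈s) = α , α-roots , trans Σα≈s s≈t

  SumOfRoots-0 : SumOfRoots 0 0#
  SumOfRoots-0 = (λ ()) , (λ ()) , refl

  SumOfRoots-1 : ∀ {x} → pow x m ≈ 1# → SumOfRoots 1 x
  SumOfRoots-1 {x} xᵐ≈1 = (λ _ → x) , (λ _ → xᵐ≈1) , +-identityʳ x

  SumOfRoots-+ : ∀ {a b s t} → SumOfRoots a s → SumOfRoots b t → SumOfRoots (a ℕ.+ b) (s + t)
  SumOfRoots-+ {a} {b} {s} {t} (α , α-roots , Σα≈s) (β , β-roots , Σβ≈t) = α ++ β , roots , sum≈s+t
    where
    roots : ∀ i → pow ((α ++ β) i) m ≈ 1#
    roots i with Fin.splitAt a i
    ... | inj₁ j = α-roots j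
    ... | inj₂ j = β-roots j
    sum≈s+t : sumFin K (a ℕ.+ b) (α ++ β) ≈ s + t
    sum≈s+t = begin
      sumFin K (a ℕ.+ b) (α ++ β)      ≡⟨ sumFin≡sum (a ℕ.+ b) (α ++ β) ⟩
      sum (α ++ β)                     ≈⟨ sum-++ a α β ⟩
      sum α + sum β                    ≡⟨ ≡.cong₂ _+_ (sumFin≡sum a α) (sumFin≡sum b β) ⟨
      sumFin K a α + sumFin K b β      ≈⟨ +-cong Σα≈s Σβ≈t ⟩
      s + t                            ∎

  SumOfRoots-natCast : ∀ r → SumOfRoots r (natCast r)
  SumOfRoots-natCast zero    = SumOfRoots-0
  SumOfRoots-natCast (suc r) = SumOfRoots-+ (SumOfRoots-1 (pow-1# m)) (SumOfRoots-natCast r)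

  SumOfRoots-trace : ∀ {h} → pow h m ≈ 1# → ∀ e → SumOfRoots e (trace K e h)
  SumOfRoots-trace hᵐ≈1 zero    = SumOfRoots-0
  SumOfRoots-trace {h} hᵐ≈1 (suc e) =
    SumOfRoots-+ (SumOfRoots-1 (pow-of-root {h} {m} (p ℕ.^ e) hᵐ≈1)) (SumOfRoots-trace hᵐ≈1 e)

module RootsOfUnity {c ℓ p} (K : ACField c ℓ p) (p-prime : Prime p) where

  open ACField K
  open RingFacts cring
  open CharacteristicP K p-prime
  open import Data.Nat using (s≤s; z≤n)
  open import Data.List using (_∷ʳ_)
  open import Relation.Binary.Reasoning.Setoid setoid

  nontrivial-root-of-unity : ∀ {m} → 1 < m → Coprime m p → ∃ λ ζ → pow ζ m ≈ 1# × ¬ ζ ≈ 1#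
  nontrivial-root-of-unity {m@(suc (suc m″))} (s≤s (s≤s z≤n)) m⊥p
    with ζ , root ← algClosed 1# (replicate m″ 1#) 1# 1≉0 = ζ , ζᵐ≈1 , ζ≉1
    where
    replicate-∷ʳ : ∀ n (x : Carrier) → replicate n x ∷ʳ x ≡ replicate (suc n) x
    replicate-∷ʳ zero    x = ≡.refl
    replicate-∷ʳ (suc n) x = ≡.cong (x ∷_) (replicate-∷ʳ n x)

    geometric≈0 : geometric ζ m ≈ 0#
    geometric≈0 = begin
      geometric ζ m                     ≈⟨ eval-ones m ζ ⟨
      eval (replicate m 1#) ζ           ≡⟨ ≡.cong (λ cs → eval (1# ∷ cs) ζ) (replicate-∷ʳ m″ 1#) ⟨
      eval ((1# ∷ replicate m″ 1#) ∷ʳ 1#) ζ  ≈⟨ root ⟩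
      0#                                ∎

    ζᵐ≈1 : pow ζ m ≈ 1#
    ζᵐ≈1 = begin
      pow ζ m                           ≈⟨ +-identityˡ _ ⟨
      0# + pow ζ m                      ≈⟨ +-congʳ geometric≈0 ⟨
      geometric ζ m + pow ζ m           ≈⟨ geometric-telescope ζ m ⟨
      ζ * geometric ζ m + 1#            ≈⟨ +-congʳ (trans (*-congˡ geometric≈0) (zeroʳ ζ)) ⟩
      0# + 1#                           ≈⟨ +-identityˡ 1# ⟩
      1#                                ∎

    ζ≉1 : ¬ ζ ≈ 1#
    ζ≉1 ζ≈1 = natCast-coprime≉0 m⊥p (begin
      natCast m                         ≈⟨ geometric-1# m ⟨
      geometric 1# m                    ≈⟨ geometric-cong m ζ≈1 ⟨
      geometric ζ m                     ≈⟨ geometric≈0 ⟩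
      0#                                ∎)

module TraceSetSize {c ℓ p} (K : ACField c ℓ p) (p-prime : Prime p)
  {e m} .{{_ : ℕ.NonZero e}} (1<m : 1 < m) (m⊥p : Coprime m p) (m∣pᵉ-1 : m ∣ p ℕ.^ e ℕ.∸ 1)
  (pⁱ-1⊥m : ∀ {i} → 0 < i → i < e → Coprime (p ℕ.^ i ℕ.∸ 1) m) where

  open ACField K
  open RingFacts cring
  open FieldFacts K
  open CharacteristicP K p-prime
  open RootsOfUnity K p-prime
  open import Algebra.Properties.Monoid.Sum +-monoid using (sum; sum-cong-≋)
  open import Algebra.Properties.CommutativeMonoid.Sum +-commutativeMonoid using (∑-comm)
  open import Algebra.Properties.Semiring.Sum semiring using (*-distribˡ-sum; *-distribʳ-sum)
  open import Data.Nat.Coprimality using (coprime-+)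
  open import Relation.Binary.Reasoning.Setoid setoid

  private instance
    p≢0 : ℕ.NonZero p
    p≢0 = prime⇒nonZero p-prime

  ζ : Carrier
  ζ = proj₁ (nontrivial-root-of-unity 1<m m⊥p)

  ζᵐ≈1 : pow ζ m ≈ 1#
  ζᵐ≈1 = proj₁ (proj₂ (nontrivial-root-of-unity 1<m m⊥p))

  ζ≉1 : ¬ ζ ≈ 1#
  ζ≉1 = proj₂ (proj₂ (nontrivial-root-of-unity 1<m m⊥p))

  ζ∈L : pow ζ (p ℕ.^ e) ≈ ζ
  ζ∈L = begin
    pow ζ (p ℕ.^ e)                  ≡⟨ ≡.cong (pow ζ) (ℕₚ.suc-pred (p ℕ.^ e) {{ℕₚ.m^n≢0 p e}}) ⟨
    ζ * pow ζ (p ℕ.^ e ℕ.∸ 1)        ≈⟨ *-congˡ (root-of-divisor ζᵐ≈1 m∣pᵉ-1) ⟩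
    ζ * 1#                           ≈⟨ *-identityʳ ζ ⟩
    ζ                                ∎

  ζᵏ-root : ∀ k → pow (pow ζ k) m ≈ 1#
  ζᵏ-root k = pow-of-root {ζ} {m} k ζᵐ≈1

  ζᵏ∈H : ∀ k → RootsH K e m (pow ζ k)
  ζᵏ∈H k = trans (pow-pow-comm ζ k (p ℕ.^ e)) (pow-cong k ζ∈L) , ζᵏ-root k

  trace-ζᵏ∈T : ∀ k → ¬ ¬ TraceSet K e m (trace K e (pow ζ k))
  trace-ζᵏ∈T k ∉T = frobenius-fixed⇒∈Fp (trace-frobenius-fixed e (proj₁ (ζᵏ∈H k)))
    λ ∈Fp → ∉T (∈Fp , pow ζ k , ζᵏ∈H k , refl)

  trace-1∈T : TraceSet K e m (trace K e 1#)
  trace-1∈T = (e , trace-1# e) , 1# , (pow-1# (p ℕ.^ e) , pow-1# m) , refl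

  ζ⁻¹ : Carrier
  ζ⁻¹ = pow ζ (m ℕ.∸ 1)

  private instance
    m≢0 : ℕ.NonZero m
    m≢0 = ℕ.>-nonZero (ℕₚ.<-trans (ℕ.s≤s ℕ.z≤n) 1<m)

  ζ⁻¹ζ≈1 : ζ⁻¹ * ζ ≈ 1#
  ζ⁻¹ζ≈1 = begin
    ζ⁻¹ * ζ                    ≈⟨ *-comm ζ⁻¹ ζ ⟩
    pow ζ (suc (m ℕ.∸ 1))      ≡⟨ ≡.cong (pow ζ) (ℕₚ.suc-pred m) ⟩
    pow ζ m                    ≈⟨ ζᵐ≈1 ⟩
    1#                         ∎

  ζ⁻¹≉1 : ¬ ζ⁻¹ ≈ 1#
  ζ⁻¹≉1 ζ⁻¹≈1 = ζ≉1 (begin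
    ζ                          ≈⟨ *-identityˡ ζ ⟨
    1# * ζ                     ≈⟨ *-congʳ ζ⁻¹≈1 ⟨
    ζ⁻¹ * ζ                    ≈⟨ ζ⁻¹ζ≈1 ⟩
    1#                         ∎)

  twist : ℕ → Carrier
  twist i = ζ⁻¹ * pow ζ (p ℕ.^ i)

  twist-root : ∀ i → pow (twist i) m ≈ 1#
  twist-root i = begin
    pow (twist i) m                              ≈⟨ pow-distrib-* ζ⁻¹ (pow ζ (p ℕ.^ i)) m ⟩
    pow ζ⁻¹ m * pow (pow ζ (p ℕ.^ i)) m          ≈⟨ *-cong (ζᵏ-root (m ℕ.∸ 1)) (ζᵏ-root (p ℕ.^ i)) ⟩
    1# * 1#                                      ≈⟨ *-identityˡ 1# ⟩
    1#                                           ∎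

  twist-0 : twist 0 ≈ 1#
  twist-0 = trans (*-congˡ (*-identityʳ ζ)) ζ⁻¹ζ≈1

  twist≉1 : ∀ {i} → 0 < i → i < e → ¬ twist i ≈ 1#
  twist≉1 {i} 0<i i<e twist≈1 = pow-coprime≉1 ζᵐ≈1 ζ≉1 (coprime-+ (pⁱ-1⊥m 0<i i<e)) (begin
    pow ζ (m ℕ.+ (p ℕ.^ i ℕ.∸ 1))          ≡⟨ ≡.cong (pow ζ) exponent ⟨
    pow ζ (m ℕ.∸ 1 ℕ.+ p ℕ.^ i)            ≈⟨ pow-+ ζ (m ℕ.∸ 1) (p ℕ.^ i) ⟩
    twist i                                ≈⟨ twist≈1 ⟩
    1#                                     ∎)
    where
    instance _ = ℕₚ.m^n≢0 p i
    exponent : m ℕ.∸ 1 ℕ.+ p ℕ.^ i ≡ m ℕ.+ (p ℕ.^ i ℕ.∸ 1)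
    exponent = ≡.trans (≡.cong (m ℕ.∸ 1 ℕ.+_) (≡.sym (ℕₚ.suc-pred (p ℕ.^ i))))
                (≡.trans (ℕₚ.+-suc (m ℕ.∸ 1) _) (≡.cong (ℕ._+ (p ℕ.^ i ℕ.∸ 1)) (ℕₚ.suc-pred m)))

  -- ∑ₖ ζ⁻ᵏ tr(ζᵏ) = ∑ᵢ ∑ₖ (ζ^(pⁱ−1))ᵏ, and only i = 0 contributes.
  character-sum : sum {m} (λ k → pow ζ⁻¹ (toℕ k) * trace K e (pow ζ (toℕ k))) ≈ natCast m
  character-sum = begin
    sum {m} (λ k → pow ζ⁻¹ (toℕ k) * trace K e (pow ζ (toℕ k)))
      ≈⟨ sum-cong-≋ {m} (expand ∘ toℕ) ⟩
    sum {m} (λ k → sum {e} (λ i → pow (twist (toℕ i)) (toℕ k)))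
      ≈⟨ ∑-comm {m} {e} (λ k i → pow (twist (toℕ i)) (toℕ k)) ⟩
    sum {e} (λ i → geometric (twist (toℕ i)) m)
      ≈⟨ sum-concentrated-at-0 e (λ i → geometric (twist i) m)
           (λ {i} 0<i i<e → geometric-vanishes {twist i} {m} (twist-root i) (twist≉1 0<i i<e)) ⟩
    geometric (twist 0) m
      ≈⟨ geometric-cong m twist-0 ⟩
    geometric 1# m
      ≈⟨ geometric-1# m ⟩
    natCast m
      ∎
    where
    expand : ∀ k → pow ζ⁻¹ k * trace K e (pow ζ k) ≈ sum {e} (λ i → pow (twist (toℕ i)) k)
    expand k = begin
      pow ζ⁻¹ k * trace K e (pow ζ k)
        ≈⟨ *-congˡ (trace≈sum e (pow ζ k)) ⟩
      pow ζ⁻¹ k * sum {e} (λ i → pow (pow ζ k) (p ℕ.^ toℕ i))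
        ≈⟨ *-distribˡ-sum {e} (pow ζ⁻¹ k) _ ⟩
      sum {e} (λ i → pow ζ⁻¹ k * pow (pow ζ k) (p ℕ.^ toℕ i))
        ≈⟨ sum-cong-≋ {e} (λ i → *-congˡ (pow-pow-comm ζ k (p ℕ.^ toℕ i))) ⟩
      sum {e} (λ i → pow ζ⁻¹ k * pow (pow ζ (p ℕ.^ toℕ i)) k)
        ≈⟨ sum-cong-≋ {e} (λ i → sym (pow-distrib-* ζ⁻¹ _ k)) ⟩
      sum {e} (λ i → pow (twist (toℕ i)) k)
        ∎

  constant-traces⇒m≈0 : ∀ {c} → (∀ (k : Fin m) → trace K e (pow ζ (toℕ k)) ≈ c) → natCast m ≈ 0#
  constant-traces⇒m≈0 {c} traces≈c = begin
    natCast m                                       ≈⟨ character-sum ⟨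
    sum {m} (λ k → pow ζ⁻¹ (toℕ k) * trace K e (pow ζ (toℕ k)))
                                                    ≈⟨ sum-cong-≋ {m} (*-congˡ ∘ traces≈c) ⟩
    sum {m} (λ k → pow ζ⁻¹ (toℕ k) * c)             ≈⟨ *-distribʳ-sum {m} c (pow ζ⁻¹ ∘ toℕ) ⟨
    geometric ζ⁻¹ m * c                             ≈⟨ *-congʳ geometric-ζ⁻¹≈0 ⟩
    0# * c                                          ≈⟨ zeroˡ c ⟩
    0#                                              ∎
    where
    geometric-ζ⁻¹≈0 : geometric ζ⁻¹ m ≈ 0#
    geometric-ζ⁻¹≈0 = geometric-vanishes {ζ⁻¹} {m} (ζᵏ-root (m ℕ.∸ 1)) ζ⁻¹≉1

  card>1 : ∀ {t} → Card K (TraceSet K e m) t → 1 < t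
  card>1 {zero}        (_ , _ , _ , onto) with () , _ ← onto _ trace-1∈T
  card>1 {suc zero}    (g , _ , _ , onto) =
    ⊥-elim (¬¬-Fin-∀ traces≈g₀ (natCast-coprime≉0 m⊥p ∘ constant-traces⇒m≈0))
    where
    traces≈g₀ : ∀ (k : Fin m) → ¬ ¬ trace K e (pow ζ (toℕ k)) ≈ g Fin.zero
    traces≈g₀ k ≉g₀ = trace-ζᵏ∈T (toℕ k) λ ∈T → ≉g₀ (≈g₀ (onto _ ∈T))
      where
      ≈g₀ : ∀ {y} → ∃ (λ (i : Fin 1) → y ≈ g i) → y ≈ g Fin.zero
      ≈g₀ (Fin.zero , y≈g₀) = y≈g₀
  card>1 {suc (suc t)} _ = ℕ.s≤s (ℕ.s≤s ℕ.z≤n)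

module SumsetArgument {c ℓ p} (K : ACField c ℓ p) (p-prime : Prime p)
  {e m t″} .{{_ : NonZero e}} (card : Card K (TraceSet K e m) (suc (suc t″))) where

  open ACField K
  open CharacteristicP K p-prime using (natCast-%; natCast-≡ₘ)
  open SumsOfRoots K m
  open RingFacts cring using (natCast-+)
  open CauchyDavenport p p-prime

  private instance
    p≢0 : NonZero p
    p≢0 = prime⇒nonZero p-prime

  open Residues p using (_≡ₘ_; -ₘ_; +-inverseʳ-≡ₘ; ≡ₘ-trans; ≡⇒≡ₘ)

  traceValue : Fin (suc (suc t″)) → Carrier
  traceValue = proj₁ card

  traceValue∈T : ∀ i → TraceSet K e m (traceValue i)
  traceValue∈T = proj₁ (proj₂ card)

  traceValue-injective : ∀ i j → traceValue i ≈ traceValue j → i ≡ j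
  traceValue-injective = proj₁ (proj₂ (proj₂ card))

  traceResidue : Fin (suc (suc t″)) → ℕ
  traceResidue i = proj₁ (proj₁ (traceValue∈T i)) % p

  traceValue≈traceResidue : ∀ i → traceValue i ≈ natCast (traceResidue i)
  traceValue≈traceResidue i = trans (proj₂ (proj₁ (traceValue∈T i))) (sym (natCast-% _))

  T̂ : ℕ → Bool
  T̂ = image traceResidue

  t≤∣T̂∣ : suc (suc t″) ≤ ∣ T̂ ∣
  t≤∣T̂∣ = count-image p traceResidue (λ i → m%n<n _ p) λ {i} {j} rᵢ≡rⱼ →
    traceValue-injective i j (trans (traceValue≈traceResidue i)
      (trans (reflexive (≡.cong natCast rᵢ≡rⱼ)) (sym (traceValue≈traceResidue j))))

  T̂-sums : ∀ {y} → T (T̂ y) → SumOfRoots e (natCast y)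
  T̂-sums y∈T̂ with i , ≡.refl ← image⁻ traceResidue y∈T̂
    with h , (_ , hᵐ≈1) , trace≈ ← proj₂ (traceValue∈T i)
    = SumOfRoots-cong (trans trace≈ (traceValue≈traceResidue i)) (SumOfRoots-trace hᵐ≈1 e)

  ⊞^-sums : ∀ k {z} → T ((T̂ ⊞^ k) z) → SumOfRoots (k ℕ.* e) (natCast z)
  ⊞^-sums zero    {z} z≡ᵇ0 with ≡.refl ← ℕₚ.≡ᵇ⇒≡ z 0 z≡ᵇ0 = SumOfRoots-0
  ⊞^-sums (suc k) {z} z∈ with x , y , _ , _ , x+y≡z , x∈ , y∈ ← ⊞-elim {T̂ ⊞^ k} {T̂} z∈ =
    SumOfRoots-cong y+x≈z (SumOfRoots-+ (T̂-sums y∈) (⊞^-sums k x∈))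
    where
    y+x≈z : natCast y + natCast x ≈ natCast z
    y+x≈z = trans (sym (natCast-+ y x)) (natCast-≡ₘ (≡ₘ-trans (≡⇒≡ₘ (ℕₚ.+-comm y x)) x+y≡z))

  residues-are-sums : ∀ {q} → p ≤ suc (q ℕ.* suc t″) → ∀ z → SumOfRoots (q ℕ.* e) (natCast z)
  residues-are-sums {q} p≤1+qt z =
    SumOfRoots-cong (natCast-% z) (⊞^-sums q (⊞^-full {T̂} {suc t″} {q} t≤∣T̂∣ p≤1+qt (m%n<n z p)))

  large-N∈W : ∀ N → e ℕ.* ceilDiv (p ℕ.∸ 1) (suc t″) ≤ N → W K m N
  large-N∈W N e*n≤N = ≡.subst (W K m) (≡.sym N≡r+q*e)
    (SumOfRoots-cong r-r≈0 (SumOfRoots-+ (SumOfRoots-natCast r) (residues-are-sums {q} p≤1+qt (-ₘ r))))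
    where
    open ℕₚ.≤-Reasoning
    n r q : ℕ
    n = ceilDiv (p ℕ.∸ 1) (suc t″)
    r = N % e
    q = N / e
    N≡r+q*e : N ≡ r ℕ.+ q ℕ.* e
    N≡r+q*e = m≡m%n+[m/n]*n N e
    n≤q : n ≤ q
    n≤q = begin
      n                ≡⟨ m*n/n≡m n e ⟨
      n ℕ.* e / e      ≤⟨ /-monoˡ-≤ e (≡.subst (_≤ N) (ℕₚ.*-comm e n) e*n≤N) ⟩
      q                ∎
    p≤1+qt : p ≤ suc (q ℕ.* suc t″)
    p≤1+qt = begin
      p                       ≡⟨ ℕₚ.suc-pred p ⟨
      suc (p ℕ.∸ 1)           ≤⟨ ℕ.s≤s (m≤⌈m/n⌉*n (p ℕ.∸ 1) t″) ⟩
      suc (n ℕ.* suc t″)      ≤⟨ ℕ.s≤s (ℕₚ.*-monoˡ-≤ (suc t″) n≤q) ⟩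
      suc (q ℕ.* suc t″)      ∎
    r-r≈0 : natCast r + natCast (-ₘ r) ≈ 0#
    r-r≈0 = trans (sym (natCast-+ r (-ₘ r))) (natCast-≡ₘ (+-inverseʳ-≡ₘ r))

W-mono-∣ : ∀ {c ℓ p} (K : ACField c ℓ p) {m′ m N} → m′ ∣ m → W K m′ N → W K m N
W-mono-∣ K m′∣m (α , α-roots , sum≈0) = α , (λ i → root-of-divisor (α-roots i) m′∣m) , sum≈0
  where open RingFacts (ACField.cring K)

large-N∈W : ∀ {c ℓ p} (K : ACField c ℓ p) → Prime p → ∀ {e m t} .{{_ : NonZero e}} →
            1 < m → Coprime m p → m ∣ p ℕ.^ e ℕ.∸ 1 →
            (∀ {i} → 0 < i → i < e → Coprime (p ℕ.^ i ℕ.∸ 1) m) →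
            Card K (TraceSet K e m) t → ∀ N → e ℕ.* ceilDiv (p ℕ.∸ 1) (t ℕ.∸ 1) ≤ N → W K m N
large-N∈W K p-prime {m = m} 1<m m⊥p m∣pᵉ-1 pⁱ-1⊥m card
  with TraceSetSize.card>1 K p-prime 1<m m⊥p m∣pᵉ-1 pⁱ-1⊥m card
... | ℕ.s≤s (ℕ.s≤s ℕ.z≤n) = SumsetArgument.large-N∈W K p-prime {m = m} card

open import Data.Nat using (_∸_; _^_; _*_)
open import Data.Nat.GCD using (gcd; gcd[m,n]∣m; gcd[m,n]∣n)
open import Data.Nat.Coprimality using (gcd≡1⇒coprime)
open import Data.Nat.Divisibility using (∣-refl)
import Data.Nat.Coprimality as Coprimality

theorem5p3 : ∀ {c ℓ' : Level} (p m : ℕ) → Prime p → 3 ≤ m →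
    gcd p m ≡ 1 → gcd (p ∸ 1) m ≡ 1 →
    (K : ACField c ℓ' p) →
    (ℓ : ℕ) → 1 ≤ ℓ → 1 < gcd (p ^ ℓ ∸ 1) m →
    (∀ e → 1 ≤ e → e < ℓ → gcd (p ^ e ∸ 1) m ≤ 1) →
    (t : ℕ) → Card K (TraceSet K ℓ (gcd (p ^ ℓ ∸ 1) m)) t →
    ((N : ℕ) → ℓ * ceilDiv (p ∸ 1) (t ∸ 1) ≤ N → W K (gcd (p ^ ℓ ∸ 1) m) N)
    × ((N : ℕ) → W K (gcd (p ^ ℓ ∸ 1) m) N → W K m N)
theorem5p3 p m p-prime 3≤m gcd[p,m]≡1 _ K ℓ 1≤ℓ 1<m′ minimal t card =
  large-N∈W K p-prime {{ℕ.>-nonZero 1≤ℓ}} 1<m′ m′⊥p (gcd[m,n]∣m (p ^ ℓ ∸ 1) m) pⁱ-1⊥m′ card ,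
  λ N → W-mono-∣ K m′∣m
  where
  m′∣m : gcd (p ^ ℓ ∸ 1) m ∣ m
  m′∣m = gcd[m,n]∣n (p ^ ℓ ∸ 1) m
  m′⊥p : Coprime (gcd (p ^ ℓ ∸ 1) m) p
  m′⊥p = coprime-divisors (Coprimality.sym (gcd≡1⇒coprime gcd[p,m]≡1)) m′∣m ∣-refl
  pⁱ-1⊥m′ : ∀ {i} → 0 < i → i < ℓ → Coprime (p ^ i ∸ 1) (gcd (p ^ ℓ ∸ 1) m)
  pⁱ-1⊥m′ {i} 0<i i<ℓ = coprime-divisors (gcd≤1⇒coprime {{m≢0}} (minimal i 0<i i<ℓ)) ∣-refl m′∣m
    where
    m≢0 : NonZero m
    m≢0 = ℕ.>-nonZero (ℕₚ.<-trans ℕ.z<s 3≤m)
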